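{- Suppose that $\underline{d}=(d_1,\dots,d_n)$ is a decreasing sequence of positive integers with even sum. Let $a$ (resp. $b$) denote the maximal (resp. minimal) element of $\underline{d}$. Then $\underline{d}$ is graphic (i.e. occurs as the sequence of vertex degrees of a simple graph) if \[ nb\geq \begin{cases} \left\lfloor\dfrac{(a+b+1)^2}{4}\right\rfloor-1 & \text{if } b \text{ is odd, or } a+b\equiv 1\pmod 4,\\[2ex] \left\lfloor\dfrac{(a+b+1)^2}{4}\right\rfloor & \text{otherwise}, \end{cases} \] where $\lfloor\cdot\rfloor$ denotes the integer part. Moreover, for any triple $(a,b,n)$ of positive integers with $b<a<n$ that fails this inequality, there is a nongraphic sequence of length $n$ having even sum with maximal element $a$ and minimal element $b$.
   Context: A finite sequence of positive integers is graphic if it occurs as the sequence of vertex degrees of a simple graph. The length of the sequence is $n$. -}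

module Defs where

open import Data.Nat as ℕ using (ℕ; zero; suc; _+_; _*_; _∸_; _/_; _%_; _≥_)
open import Data.Bool using (Bool; false; if_then_else_)
open import Data.Fin as Fin using (Fin)
open import Data.Product using (Σ; ∃; _×_)
open import Data.Sum using (_⊎_)
open import Relation.Binary.PropositionalEquality using (_≡_)

sumFin : ∀ {n} → (Fin n → ℕ) → ℕ
sumFin {zero} d = 0
sumFin {suc n} d = d Fin.zero + sumFin {n} (λ i → d (Fin.suc i))

record SimpleGraph (n : ℕ) : Set where
  field
    adj      : Fin n → Fin n → Bool
    adj-sym  : ∀ i j → adj i j ≡ adj j i
    loopless : ∀ i → adj i i ≡ false

open SimpleGraph public

degree : ∀ {n} → SimpleGraph n → Fin n → ℕ
degree G i = sumFin (λ j → if adj G i j then 1 else 0)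

Graphic : ∀ {n} → (Fin n → ℕ) → Set
Graphic {n} d = Σ (SimpleGraph n) λ G → ∀ i → degree G i ≡ d i

Decreasing : ∀ {n} → (Fin n → ℕ) → Set
Decreasing d = ∀ i j → i Fin.≤ j → d j ℕ.≤ d i

Positive : ∀ {n} → (Fin n → ℕ) → Set
Positive d = ∀ i → 1 ℕ.≤ d i

EvenSum : ∀ {n} → (Fin n → ℕ) → Set
EvenSum d = sumFin d % 2 ≡ 0

IsMax : ∀ {n} → (Fin n → ℕ) → ℕ → Set
IsMax d a = (∃ λ i → d i ≡ a) × (∀ i → d i ℕ.≤ a)

IsMin : ∀ {n} → (Fin n → ℕ) → ℕ → Set
IsMin d b = (∃ λ i → d i ≡ b) × (∀ i → b ℕ.≤ d i)

CaseOne : ℕ → ℕ → Set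
CaseOne a b = (b % 2 ≡ 1) ⊎ ((a + b) % 4 ≡ 1)

base : ℕ → ℕ → ℕ
base a b = ((a + b + 1) * (a + b + 1)) / 4

Ineq : ℕ → ℕ → ℕ → Set
Ineq a b n = (CaseOne a b → n * b ≥ base a b ∸ 1)
           × ((CaseOne a b → Data.Empty.⊥) → n * b ≥ base a b)
  where import Data.Empty

-- Sufficiency goes through the Erdős–Gallai criterion. For k ≤ b its k-th inequality is immediate
-- from a < n; for k > b, writing q = a + b + 1 − k, the bound kq ≤ ⌊(a + b + 1)²/4⌋ ≤ nb + 1 gives
-- ka ≤ k(k − 1) + (n − k)b + 1, and equality throughout would make the degree sum odd.
-- The criterion itself is proved by induction: lowering by one both the last entry and the last
-- entry of the leading block of maximal entries preserves the Erdős–Gallai inequalities, and a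
-- realisation of the lowered sequence is raised back by adding an edge, after one switch if needed.
-- For sharpness, with k = ⌊(a + b + 1)/2⌋ the sequence (a, …, a, a − p, b, …, b) with k leading
-- entries violates the k-th inequality Σ_{i<k} dᵢ ≤ k(k − 1) + Σ_{i≥k} dᵢ, which double counting
-- shows for every degree sequence.

module Submission where

open import Defs
open import Data.Bool as Bool using (Bool; true; false; if_then_else_; not; T; _∧_; _∨_; _xor_)
open import Data.Bool.Properties using (∧-comm; ∨-comm; ∧-zeroʳ; ¬-not)
open import Data.Empty using (⊥-elim)
open import Data.Fin as Fin using (Fin; toℕ; fromℕ<)
open import Data.Fin.Properties
  using (¬∀⟶∃¬; fromℕ<-toℕ; punchInᵢ≢i; toℕ<n; toℕ-fromℕ<; toℕ-injective; toℕ-inject₁; toℕ-fromℕ)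
open import Data.Nat
open import Data.Nat.DivMod
  using (m≡m%n+[m/n]*n; m*n/n≡m; /-monoˡ-≤; m%n<n; m*n%n≡0; +-distrib-/-∣ʳ; m<n⇒m/n≡0; [m+kn]%n≡m%n)
open import Data.Nat.Divisibility using (divides-refl)
open import Data.Nat.Induction using (<-wellFounded)
open import Data.Nat.Properties
open import Data.Nat.Tactic.RingSolver using (solve-∀)
open import Algebra.Properties.CommutativeMonoid.Sum +-0-commutativeMonoid
  using (sum; sum-syntax; sum-cong-≗; ∑-distrib-+; ∑-comm; sum-init-last; sum-replicate-zero; sum-remove)
open import Data.Product using (Σ; Σ-syntax; ∃-syntax; _×_; _,_; proj₁; proj₂)
open import Data.Sum using (_⊎_; inj₁; inj₂; swap)
open import Function using (_∘_)
open import Induction.WellFounded using (Acc; acc)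
open import Relation.Binary.Definitions using (tri<; tri≈; tri>)
open import Relation.Binary.PropositionalEquality
open import Relation.Nullary using (¬_; yes; no; does; Dec)
open import Relation.Nullary.Decidable using (_⊎-dec_; dec-true; dec-false)

b2n : Bool → ℕ
b2n b = if b then 1 else 0

b2n-not : ∀ b → b2n (not b) ≡ (if b then 0 else 1)
b2n-not true  = refl
b2n-not false = refl

b2n≤1 : ∀ b → b2n b ≤ 1
b2n≤1 true  = ≤-refl
b2n≤1 false = z≤n

sumFin≡sum : ∀ {n} (f : Fin n → ℕ) → sumFin f ≡ sum f
sumFin≡sum {zero}  f = refl
sumFin≡sum {suc n} f = cong (f Fin.zero +_) (sumFin≡sum (f ∘ Fin.suc))

sum-const : ∀ n c → ∑[ i < n ] c ≡ n * c
sum-const zero    c = refl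
sum-const (suc n) c = cong (c +_) (sum-const n c)

sum-≡0 : ∀ {n} {f : Fin n → ℕ} → (∀ i → f i ≡ 0) → sum f ≡ 0
sum-≡0 {n} f≡0 = trans (sum-cong-≗ f≡0) (sum-replicate-zero n)

sum-mono-≤ : ∀ {n} {f g : Fin n → ℕ} → (∀ i → f i ≤ g i) → sum f ≤ sum g
sum-mono-≤ {zero}  f≤g = z≤n
sum-mono-≤ {suc n} f≤g = +-mono-≤ (f≤g Fin.zero) (sum-mono-≤ (f≤g ∘ Fin.suc))

≤-sum : ∀ {n} (f : Fin n → ℕ) i → f i ≤ sum f
≤-sum f Fin.zero    = m≤m+n _ _
≤-sum f (Fin.suc i) = ≤-trans (≤-sum (f ∘ Fin.suc) i) (m≤n+m _ _)

+-cancel-≤-≡ : ∀ {a b c d} → a ≤ b → c ≤ d → a + c ≡ b + d → a ≡ b × c ≡ d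
+-cancel-≤-≡ {a} {b} {c} {d} a≤b c≤d eq =
  ≤-antisym a≤b (+-cancelʳ-≤ c b a (≤-trans (+-monoʳ-≤ b c≤d) (≤-reflexive (sym eq)))) ,
  ≤-antisym c≤d (+-cancelˡ-≤ a d c (≤-trans (+-monoˡ-≤ d a≤b) (≤-reflexive (sym eq))))

sum-mono-≤-≡⇒≗ : ∀ {n} {f g : Fin n → ℕ} → (∀ i → f i ≤ g i) → sum f ≡ sum g → ∀ i → f i ≡ g i
sum-mono-≤-≡⇒≗ {suc n} f≤g eq i
  with f₀≡g₀ , rest ← +-cancel-≤-≡ (f≤g Fin.zero) (sum-mono-≤ (f≤g ∘ Fin.suc)) eq
  with i
... | Fin.zero  = f₀≡g₀
... | Fin.suc i = sum-mono-≤-≡⇒≗ (f≤g ∘ Fin.suc) rest i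

sum-update : ∀ {n} (f g : Fin n → ℕ) y → (∀ j → j ≢ y → g j ≡ f j) → sum g + f y ≡ sum f + g y
sum-update {suc n} f g y g≗f = begin
  sum g + f y                         ≡⟨ cong (_+ f y) (sum-remove {i = y} g) ⟩
  g y + sum (g ∘ Fin.punchIn y) + f y ≡⟨ cong (λ s → g y + s + f y) (sum-cong-≗ (λ j → g≗f _ (punchInᵢ≢i y j))) ⟩
  g y + sum (f ∘ Fin.punchIn y) + f y ≡⟨ swap-ends (g y) _ (f y) ⟩
  f y + sum (f ∘ Fin.punchIn y) + g y ≡⟨ cong (_+ g y) (sum-remove {i = y} f) ⟨
  sum f + g y                         ∎
  where
    open ≡-Reasoning
    swap-ends : ∀ a b c → a + b + c ≡ c + b + a
    swap-ends = solve-∀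

_≟ᵇ_ : ∀ {n} → Fin n → Fin n → Bool
i ≟ᵇ x = does (i Fin.≟ x)

≟ᵇ-refl : ∀ {n} (x : Fin n) → (x ≟ᵇ x) ≡ true
≟ᵇ-refl x = dec-true (x Fin.≟ x) refl

≟ᵇ-≢ : ∀ {n} {i x : Fin n} → i ≢ x → (i ≟ᵇ x) ≡ false
≟ᵇ-≢ {i = i} {x} = dec-false (i Fin.≟ x)

δ : ∀ {n} → Fin n → Fin n → ℕ
δ x i = b2n (i ≟ᵇ x)

δ-refl : ∀ {n} (x : Fin n) → δ x x ≡ 1
δ-refl x = cong b2n (≟ᵇ-refl x)

δ-≢ : ∀ {n} {x i : Fin n} → i ≢ x → δ x i ≡ 0
δ-≢ i≢x = cong b2n (≟ᵇ-≢ i≢x)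

sum-δ : ∀ {n} (x : Fin n) → sum (δ x) ≡ 1
sum-δ {n} x = begin
  sum (δ x)                ≡⟨ +-identityʳ _ ⟨
  sum (δ x) + 0            ≡⟨ sum-update (λ _ → 0) (δ x) x (λ _ → δ-≢) ⟩
  ∑[ i < n ] 0 + δ x x     ≡⟨ cong₂ _+_ (sum-replicate-zero n) (δ-refl x) ⟩
  1                        ∎
  where open ≡-Reasoning

<ᵇ-true : ∀ {j k} → j < k → (j <ᵇ k) ≡ true
<ᵇ-true {zero}  {suc k} _         = refl
<ᵇ-true {suc j} {suc k} (s≤s j<k) = <ᵇ-true j<k

<ᵇ-false : ∀ {j k} → k ≤ j → (j <ᵇ k) ≡ false
<ᵇ-false {j}     {zero}  _         = refl
<ᵇ-false {suc j} {suc k} (s≤s k≤j) = <ᵇ-false k≤j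

≡ᵇ-refl : ∀ j → (j ≡ᵇ j) ≡ true
≡ᵇ-refl j = dec-true (j ≟ j) refl

≡ᵇ-false : ∀ {j p} → j ≢ p → (j ≡ᵇ p) ≡ false
≡ᵇ-false {j} {p} = dec-false (j ≟ p)

≡ᵇ-true⇒≡ : ∀ {j p} → (j ≡ᵇ p) ≡ true → j ≡ p
≡ᵇ-true⇒≡ {j} {p} eq = ≡ᵇ⇒≡ j p (subst T (sym eq) _)

<ᵇ-true⇒< : ∀ {j k} → (j <ᵇ k) ≡ true → j < k
<ᵇ-true⇒< {j} {k} eq = <ᵇ⇒< j k (subst T (sym eq) _)

≟ᵇ-toℕ : ∀ {n} (i x : Fin n) → (i ≟ᵇ x) ≡ (toℕ i ≡ᵇ toℕ x)
≟ᵇ-toℕ i x with i Fin.≟ x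
... | yes refl = sym (≡ᵇ-refl (toℕ i))
... | no i≢x   = sym (≡ᵇ-false (i≢x ∘ toℕ-injective))

sumBelow : ℕ → (ℕ → ℕ) → ℕ
sumBelow n f = ∑[ i < n ] f (toℕ i)

upto : ℕ → (ℕ → ℕ) → ℕ → ℕ
upto k f j = if j <ᵇ k then f j else 0

from : ℕ → (ℕ → ℕ) → ℕ → ℕ
from k f j = if j <ᵇ k then 0 else f j

at : ℕ → (ℕ → ℕ) → ℕ → ℕ
at p f j = if j ≡ᵇ p then f j else 0

δ-fromℕ< : ∀ {n p} (p<n : p < n) (i : Fin n) → δ (fromℕ< p<n) i ≡ at p (λ _ → 1) (toℕ i)
δ-fromℕ< p<n i = cong b2n (trans (≟ᵇ-toℕ i (fromℕ< p<n)) (cong (toℕ i ≡ᵇ_) (toℕ-fromℕ< p<n)))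

from-< : ∀ {k j} f → j < k → from k f j ≡ 0
from-< {k} {j} f j<k rewrite <ᵇ-true j<k = refl

from-≥ : ∀ {k j} f → k ≤ j → from k f j ≡ f j
from-≥ {k} {j} f k≤j rewrite <ᵇ-false k≤j = refl

sumBelow-cong : ∀ n {f g : ℕ → ℕ} → (∀ j → j < n → f j ≡ g j) → sumBelow n f ≡ sumBelow n g
sumBelow-cong n f≗g = sum-cong-≗ (λ i → f≗g (toℕ i) (toℕ<n i))

sumBelow-mono-≤ : ∀ n {f g : ℕ → ℕ} → (∀ j → j < n → f j ≤ g j) → sumBelow n f ≤ sumBelow n g
sumBelow-mono-≤ n f≤g = sum-mono-≤ (λ i → f≤g (toℕ i) (toℕ<n i))

sumBelow-mono-≤-≡⇒≗ : ∀ n {f g : ℕ → ℕ} → (∀ j → j < n → f j ≤ g j) →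
                      sumBelow n f ≡ sumBelow n g → ∀ j → j < n → f j ≡ g j
sumBelow-mono-≤-≡⇒≗ n {f} {g} f≤g eq j j<n =
  subst (λ x → f x ≡ g x) (toℕ-fromℕ< j<n)
        (sum-mono-≤-≡⇒≗ (λ i → f≤g (toℕ i) (toℕ<n i)) eq (fromℕ< j<n))

≤-sumBelow : ∀ n f {p} → p < n → f p ≤ sumBelow n f
≤-sumBelow n f p<n = subst (_≤ sumBelow n f) (cong f (toℕ-fromℕ< p<n)) (≤-sum (f ∘ toℕ) (fromℕ< p<n))

sumBelow-+ : ∀ n f g → sumBelow n (λ j → f j + g j) ≡ sumBelow n f + sumBelow n g
sumBelow-+ n f g = ∑-distrib-+ {n} (f ∘ toℕ) (g ∘ toℕ)

sumBelow-const : ∀ n c → sumBelow n (λ _ → c) ≡ n * c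
sumBelow-const = sum-const

sumBelow-* : ∀ n k f → sumBelow n (λ j → k * f j) ≡ k * sumBelow n f
sumBelow-* zero    k f = sym (*-zeroʳ k)
sumBelow-* (suc n) k f = begin
  k * f 0 + sumBelow n (λ j → k * f (suc j)) ≡⟨ cong (k * f 0 +_) (sumBelow-* n k (f ∘ suc)) ⟩
  k * f 0 + k * sumBelow n (f ∘ suc)         ≡⟨ *-distribˡ-+ k (f 0) _ ⟨
  k * sumBelow (suc n) f                     ∎
  where open ≡-Reasoning

sumBelow-snoc : ∀ n f → sumBelow (suc n) f ≡ sumBelow n f + f n
sumBelow-snoc zero    f = +-comm (f 0) 0
sumBelow-snoc (suc n) f = trans (cong (f 0 +_) (sumBelow-snoc n (f ∘ suc))) (sym (+-assoc (f 0) _ _))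

sumBelow-split : ∀ n k f → k ≤ n → sumBelow n f ≡ sumBelow k f + sumBelow n (from k f)
sumBelow-split n       zero    f _ = refl
sumBelow-split (suc n) (suc k) f (s≤s k≤n) =
  trans (cong (f 0 +_) (sumBelow-split n k (f ∘ suc) k≤n)) (sym (+-assoc (f 0) _ _))

sumBelow-upto : ∀ n k f → k ≤ n → sumBelow n (upto k f) ≡ sumBelow k f
sumBelow-upto n       zero    f _ = sum-≡0 {n} (λ _ → refl)
sumBelow-upto (suc n) (suc k) f (s≤s k≤n) = cong (f 0 +_) (sumBelow-upto n k (f ∘ suc) k≤n)

sumBelow-from-const : ∀ n k c → sumBelow n (from k (λ _ → c)) ≡ (n ∸ k) * c
sumBelow-from-const n       zero    c = sumBelow-const n c
sumBelow-from-const zero    (suc k) c = refl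
sumBelow-from-const (suc n) (suc k) c = sumBelow-from-const n k c

sumBelow-at : ∀ n p f → p < n → sumBelow n (at p f) ≡ f p
sumBelow-at (suc n) zero    f _ = trans (cong (f 0 +_) (sum-≡0 {n} (λ _ → refl))) (+-identityʳ _)
sumBelow-at (suc n) (suc p) f (s≤s p<n) = sumBelow-at n p (f ∘ suc) p<n

sumBelow-at-≥ : ∀ n p f → n ≤ p → sumBelow n (at p f) ≡ 0
sumBelow-at-≥ zero    p       f _ = refl
sumBelow-at-≥ (suc n) (suc p) f (s≤s n≤p) = sumBelow-at-≥ n p (f ∘ suc) n≤p

Even : ℕ → Set
Even x = ∃[ h ] x ≡ 2 * h

%2≡0⇒Even : ∀ x → x % 2 ≡ 0 → Even x
%2≡0⇒Even x x%2≡0 = x / 2 , (begin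
  x                   ≡⟨ m≡m%n+[m/n]*n x 2 ⟩
  x % 2 + x / 2 * 2   ≡⟨ cong (_+ x / 2 * 2) x%2≡0 ⟩
  x / 2 * 2           ≡⟨ *-comm (x / 2) 2 ⟩
  2 * (x / 2)         ∎)
  where open ≡-Reasoning

Even-*-suc : ∀ k → Even (k * suc k)
Even-*-suc zero = 0 , refl
Even-*-suc (suc k) with h , eq ← Even-*-suc k = h + suc k , (begin
  suc k * suc (suc k)       ≡⟨ *-comm (suc k) (suc (suc k)) ⟩
  suc k + (suc k + k * suc k) ≡⟨ cong (λ x → suc k + (suc k + x)) eq ⟩
  suc k + (suc k + 2 * h)   ≡⟨ solve k h ⟩
  2 * (h + suc k)           ∎)
  where
    open ≡-Reasoning
    solve : ∀ k h → suc k + (suc k + 2 * h) ≡ 2 * (h + suc k)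
    solve = solve-∀

Even-2+ : ∀ x → Even (2 + x) → Even x
Even-2+ x (zero , ())
Even-2+ x (suc h , eq) = h , suc-injective (trans (suc-injective eq) (+-suc h (h + 0)))

%2-cases : ∀ x → x % 2 ≡ 0 ⊎ x % 2 ≡ 1
%2-cases x with x % 2 | m%n<n x 2
... | 0           | _               = inj₁ refl
... | 1           | _               = inj₂ refl
... | suc (suc _) | s≤s (s≤s ())

-- The Erdős–Gallai inequalities

Antitone : ℕ → (ℕ → ℕ) → Set
Antitone n d = ∀ i j → i ≤ j → j < n → d j ≤ d i

tailMin : ℕ → ℕ → (ℕ → ℕ) → ℕ
tailMin n k d = sumBelow n (from k (λ j → d j ⊓ k))

ErdősGallai : ℕ → (ℕ → ℕ) → Set
ErdősGallai n d = ∀ k → k ≤ n → sumBelow k d ≤ k * (k ∸ 1) + tailMin n k d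

lower : ℕ → (ℕ → ℕ) → ℕ → ℕ
lower p f j = if j ≡ᵇ p then pred (f j) else f j

lower-≡ : ∀ p f → lower p f p ≡ pred (f p)
lower-≡ p f rewrite ≡ᵇ-refl p = refl

lower-≢ : ∀ p f {j} → j ≢ p → lower p f j ≡ f j
lower-≢ p f {j} j≢p rewrite ≡ᵇ-false j≢p = refl

lower-≤ : ∀ p f j → lower p f j ≤ f j
lower-≤ p f j with j ≡ᵇ p
... | true  = pred[n]≤n
... | false = ≤-refl

lower-+-at : ∀ p f j → 1 ≤ f p → lower p f j + at p (λ _ → 1) j ≡ f j
lower-+-at p f j 1≤fp with j ≡ᵇ p in eq
... | true rewrite ≡ᵇ-true⇒≡ {j} {p} eq = trans (+-comm _ 1) (suc-pred (f p) ⦃ >-nonZero 1≤fp ⦄)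
... | false = +-identityʳ _

sumBelow-lower-≥ : ∀ k p f → k ≤ p → sumBelow k (lower p f) ≡ sumBelow k f
sumBelow-lower-≥ k p f k≤p = sumBelow-cong k (λ j j<k → lower-≢ p f (<⇒≢ (<-≤-trans j<k k≤p)))

sumBelow-lower : ∀ k p f → p < k → 1 ≤ f p → suc (sumBelow k (lower p f)) ≡ sumBelow k f
sumBelow-lower k p f p<k 1≤fp = begin
  suc (sumBelow k (lower p f))                          ≡⟨ +-comm 1 _ ⟩
  sumBelow k (lower p f) + 1                            ≡⟨ cong (sumBelow k (lower p f) +_) (sumBelow-at k p (λ _ → 1) p<k) ⟨
  sumBelow k (lower p f) + sumBelow k (at p (λ _ → 1))  ≡⟨ sumBelow-+ k (lower p f) (at p (λ _ → 1)) ⟨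
  sumBelow k (λ j → lower p f j + at p (λ _ → 1) j)     ≡⟨ sumBelow-cong k (λ j _ → lower-+-at p f j 1≤fp) ⟩
  sumBelow k f                                          ∎
  where open ≡-Reasoning

tailMin-lower-< : ∀ n k p f → p < k → tailMin n k (lower p f) ≡ tailMin n k f
tailMin-lower-< n k p f p<k = sumBelow-cong n pt
  where
    pt : ∀ j → j < n → from k (λ j → lower p f j ⊓ k) j ≡ from k (λ j → f j ⊓ k) j
    pt j _ with j <? k
    ... | yes j<k rewrite <ᵇ-true j<k = refl
    ... | no j≮k rewrite <ᵇ-false {j} {k} (≮⇒≥ j≮k) | lower-≢ p f {j} (λ j≡p → j≮k (subst (_< k) (sym j≡p) p<k)) = refl

tailMin-lower-> : ∀ n k p f → k < f p → tailMin n k (lower p f) ≡ tailMin n k f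
tailMin-lower-> n k p f k<fp = sumBelow-cong n pt
  where
    pt : ∀ j → j < n → from k (λ j → lower p f j ⊓ k) j ≡ from k (λ j → f j ⊓ k) j
    pt j _ with j ≡ᵇ p in eq
    ... | false = refl
    ... | true rewrite ≡ᵇ-true⇒≡ {j} {p} eq =
      cong (λ x → if p <ᵇ k then 0 else x)
           (trans (m≥n⇒m⊓n≡n (<⇒≤pred k<fp)) (sym (m≥n⇒m⊓n≡n (<⇒≤ k<fp))))

tailMin-lower : ∀ n k p f → tailMin n k f ≤ suc (tailMin n k (lower p f))
tailMin-lower n k p f = begin
  tailMin n k f                                                      ≤⟨ sumBelow-mono-≤ n (λ j _ → pt j) ⟩
  sumBelow n (λ j → from k (λ j → lower p f j ⊓ k) j + at p (λ _ → 1) j)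
    ≡⟨ sumBelow-+ n (from k (λ j → lower p f j ⊓ k)) (at p (λ _ → 1)) ⟩
  tailMin n k (lower p f) + sumBelow n (at p (λ _ → 1))              ≤⟨ +-monoʳ-≤ (tailMin n k (lower p f)) at≤1 ⟩
  tailMin n k (lower p f) + 1                                        ≡⟨ +-comm _ 1 ⟩
  suc (tailMin n k (lower p f))                                      ∎
  where
    open ≤-Reasoning
    at≤1 : sumBelow n (at p (λ _ → 1)) ≤ 1
    at≤1 with p <? n
    ... | yes p<n = ≤-reflexive (sumBelow-at n p (λ _ → 1) p<n)
    ... | no p≮n = ≤-trans (≤-reflexive (sumBelow-at-≥ n p (λ _ → 1) (≮⇒≥ p≮n))) z≤n
    ⊓-lower : ∀ x → x ⊓ k ≤ pred x ⊓ k + 1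
    ⊓-lower zero    = z≤n
    ⊓-lower (suc x) = ≤-trans (⊓-monoʳ-≤ (suc x) (n≤1+n k)) (≤-reflexive (+-comm 1 (x ⊓ k)))
    pt : ∀ j → from k (λ j → f j ⊓ k) j ≤ from k (λ j → lower p f j ⊓ k) j + at p (λ _ → 1) j
    pt j with j <ᵇ k | j ≡ᵇ p in eq
    ... | true  | _     = z≤n
    ... | false | false = ≤-reflexive (sym (+-identityʳ _))
    ... | false | true rewrite ≡ᵇ-true⇒≡ {j} {p} eq = ⊓-lower (f p)

⊓-suc : ∀ x k → x ⊓ suc k ≡ x ⊓ k + b2n (k <ᵇ x)
⊓-suc zero    k       = refl
⊓-suc (suc x) zero    = cong suc (⊓-zeroʳ x)
⊓-suc (suc x) (suc k) = cong suc (⊓-suc x k)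

tailMin-suc : ∀ n k f →
  tailMin n (suc k) f ≡ sumBelow n (from (suc k) (λ j → f j ⊓ k)) + sumBelow n (from (suc k) (λ j → b2n (k <ᵇ f j)))
tailMin-suc n k f = trans (sumBelow-cong n (λ j _ → pt j))
                          (sumBelow-+ n (from (suc k) (λ j → f j ⊓ k)) (from (suc k) (λ j → b2n (k <ᵇ f j))))
  where
    pt : ∀ j → from (suc k) (λ j → f j ⊓ suc k) j ≡ from (suc k) (λ j → f j ⊓ k) j + from (suc k) (λ j → b2n (k <ᵇ f j)) j
    pt j with j <ᵇ suc k
    ... | true  = refl
    ... | false = ⊓-suc (f j) k

tailMin-unfold : ∀ n k f → k < n → tailMin n k f ≡ f k ⊓ k + sumBelow n (from (suc k) (λ j → f j ⊓ k))
tailMin-unfold n k f k<n = begin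
  tailMin n k f                                              ≡⟨ sumBelow-cong n (λ j _ → pt j) ⟩
  sumBelow n (λ j → at k h j + from (suc k) h j)             ≡⟨ sumBelow-+ n (at k h) (from (suc k) h) ⟩
  sumBelow n (at k h) + sumBelow n (from (suc k) h)          ≡⟨ cong (_+ sumBelow n (from (suc k) h)) (sumBelow-at n k h k<n) ⟩
  f k ⊓ k + sumBelow n (from (suc k) h)                      ∎
  where
    open ≡-Reasoning
    h : ℕ → ℕ
    h j = f j ⊓ k
    pt : ∀ j → from k h j ≡ at k h j + from (suc k) h j
    pt j with <-cmp j k
    ... | tri< j<k _ _ rewrite <ᵇ-true j<k | ≡ᵇ-false (<⇒≢ j<k) | <ᵇ-true (m<n⇒m<1+n j<k) = refl
    ... | tri≈ _ refl _ rewrite <ᵇ-false (≤-refl {j}) | ≡ᵇ-refl j | <ᵇ-true (n<1+n j) = sym (+-identityʳ _)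
    ... | tri> _ _ k<j rewrite <ᵇ-false (<⇒≤ k<j) | ≡ᵇ-false (>⇒≢ k<j) | <ᵇ-false {j} {suc k} k<j = refl

lower-antitone : ∀ n p f → Antitone n f → (suc p < n → f (suc p) < f p) → Antitone n (lower p f)
lower-antitone n p f antitone drop i j i≤j j<n with i ≟ p
... | no i≢p = ≤-trans (lower-≤ p f j) (≤-trans (antitone i j i≤j j<n) (≤-reflexive (sym (lower-≢ p f i≢p))))
... | yes refl with j ≟ i
...   | yes refl = ≤-refl
...   | no j≢i = begin
  lower i f j      ≡⟨ lower-≢ i f j≢i ⟩
  f j              ≤⟨ antitone (suc i) j i<j j<n ⟩
  f (suc i)        ≤⟨ <⇒≤pred (drop (<-≤-trans (s≤s i<j) j<n)) ⟩
  pred (f i)         ≡⟨ lower-≡ i f ⟨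
  lower i f i      ∎
  where
    open ≤-Reasoning
    i<j : i < j
    i<j = ≤∧≢⇒< i≤j (≢-sym j≢i)

-- Inside the block of maximal entries, the (k + 1)-st Erdős–Gallai inequality yields the k-th one.
scale-down-bound : ∀ k D Y C → suc k * D ≤ suc k * k + (Y + C) → suc (k * C) ≤ Y → suc (k * D) ≤ k * k + Y
scale-down-bound k D Y C bound-suc C<Y with D ≤? k + C
... | yes D≤k+C = begin
  suc (k * D)         ≤⟨ s≤s (*-monoʳ-≤ k D≤k+C) ⟩
  suc (k * (k + C))   ≡⟨ cong suc (*-distribˡ-+ k k C) ⟩
  suc (k * k + k * C) ≡⟨ +-suc (k * k) (k * C) ⟨
  k * k + suc (k * C) ≤⟨ +-monoʳ-≤ (k * k) C<Y ⟩
  k * k + Y           ∎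
  where open ≤-Reasoning
... | no D≰k+C = +-cancelˡ-≤ (k + C) _ _ (begin
  k + C + suc (k * D) ≡⟨ +-suc (k + C) (k * D) ⟩
  suc (k + C) + k * D ≤⟨ +-monoˡ-≤ (k * D) (≰⇒> D≰k+C) ⟩
  suc k * D           ≤⟨ bound-suc ⟩
  suc k * k + (Y + C) ≡⟨ rearrange k Y C ⟩
  k + C + (k * k + Y) ∎)
  where
    open ≤-Reasoning
    rearrange : ∀ k Y C → suc k * k + (Y + C) ≡ k + C + (k * k + Y)
    rearrange = solve-∀

-- Graph surgery

row : ∀ {n} → SimpleGraph n → Fin n → Fin n → ℕ
row G i j = b2n (adj G i j)

degree-∑ : ∀ {n} (G : SimpleGraph n) i → degree G i ≡ sum (row G i)
degree-∑ G i = sumFin≡sum (row G i)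

degree-update : ∀ {n} (G H : SimpleGraph n) e p → (∀ j → j ≢ p → adj H e j ≡ adj G e j) →
                degree H e + row G e p ≡ degree G e + row H e p
degree-update G H e p H≗G = begin
  degree H e + row G e p      ≡⟨ cong (_+ row G e p) (degree-∑ H e) ⟩
  sum (row H e) + row G e p   ≡⟨ sum-update (row G e) (row H e) p (λ j j≢p → cong b2n (H≗G j j≢p)) ⟩
  sum (row G e) + row H e p   ≡⟨ cong (_+ row H e p) (degree-∑ G e) ⟨
  degree G e + row H e p      ∎
  where open ≡-Reasoning

joins : ∀ {n} → Fin n → Fin n → Fin n → Fin n → Bool
joins x y i j = (i ≟ᵇ x ∧ j ≟ᵇ y) ∨ (i ≟ᵇ y ∧ j ≟ᵇ x)

joins-sym : ∀ {n} (x y i j : Fin n) → joins x y i j ≡ joins x y j i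
joins-sym x y i j = trans (cong₂ _∨_ (∧-comm (i ≟ᵇ x) (j ≟ᵇ y)) (∧-comm (i ≟ᵇ y) (j ≟ᵇ x)))
                          (∨-comm (j ≟ᵇ y ∧ i ≟ᵇ x) _)

joins-≢ : ∀ {n} {x y i j : Fin n} → i ≢ x ⊎ j ≢ y → i ≢ y ⊎ j ≢ x → joins x y i j ≡ false
joins-≢ {x = x} {y} {i} {j} not-xy not-yx = cong₂ _∨_ (∧-false not-xy) (∧-false not-yx)
  where
    ∧-false : ∀ {a b c d : Fin _} → a ≢ b ⊎ c ≢ d → (a ≟ᵇ b ∧ c ≟ᵇ d) ≡ false
    ∧-false (inj₁ a≢b) rewrite ≟ᵇ-≢ a≢b = refl
    ∧-false {a} {b} (inj₂ c≢d) rewrite ≟ᵇ-≢ c≢d = ∧-zeroʳ (a ≟ᵇ b)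

joins-irrefl : ∀ {n} {x y : Fin n} → x ≢ y → ∀ i → joins x y i i ≡ false
joins-irrefl {x = x} {y} x≢y i = joins-≢ (avoids-one i) (swap (avoids-one i))
  where
    avoids-one : ∀ i → i ≢ x ⊎ i ≢ y
    avoids-one i with i Fin.≟ x
    ... | yes refl = inj₂ x≢y
    ... | no i≢x   = inj₁ i≢x

joins-xy : ∀ {n} (x y : Fin n) → joins x y x y ≡ true
joins-xy x y rewrite ≟ᵇ-refl x | ≟ᵇ-refl y = refl

ends : ∀ {n} → Fin n → Fin n → Fin n → ℕ
ends x y i = δ x i + δ y i

toggle : ∀ {n} (G : SimpleGraph n) {x y : Fin n} → x ≢ y → SimpleGraph n
toggle G {x} {y} x≢y = record
  { adj      = λ i j → joins x y i j xor adj G i j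
  ; adj-sym  = λ i j → cong₂ _xor_ (joins-sym x y i j) (adj-sym G i j)
  ; loopless = λ i → trans (cong (_xor adj G i i) (joins-irrefl x≢y i)) (loopless G i)
  }

module _ {n} (G : SimpleGraph n) {x y : Fin n} (x≢y : x ≢ y) where

  toggle-adj-≢ : ∀ {i j} → i ≢ x ⊎ j ≢ y → i ≢ y ⊎ j ≢ x → adj (toggle G x≢y) i j ≡ adj G i j
  toggle-adj-≢ not-xy not-yx = cong (_xor _) (joins-≢ not-xy not-yx)

  toggle-adj-xy : adj (toggle G x≢y) x y ≡ not (adj G x y)
  toggle-adj-xy = cong (_xor adj G x y) (joins-xy x y)

  toggle-adj-yx : adj (toggle G x≢y) y x ≡ not (adj G x y)
  toggle-adj-yx = trans (adj-sym (toggle G x≢y) y x) toggle-adj-xy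

  private
    H : SimpleGraph n
    H = toggle G x≢y

    Balanced : Bool → ℕ → Fin n → Set
    Balanced c e i = degree H i + (if c then e else 0) ≡ degree G i + (if c then 0 else e)

    balanced-endpoint : ∀ e p → (∀ j → j ≢ p → adj H e j ≡ adj G e j) →
                        adj G e p ≡ adj G x y → adj H e p ≡ not (adj G x y) → Balanced (adj G x y) 1 e
    balanced-endpoint e p H≗G G-ep H-ep =
      subst₂ (λ u v → degree H e + u ≡ degree G e + v) (cong b2n G-ep) (trans (cong b2n H-ep) (b2n-not (adj G x y)))
             (degree-update G H e p H≗G)

    balanced : ∀ i → Balanced (adj G x y) (ends x y i) i
    balanced i = by-cases (i Fin.≟ x) (i Fin.≟ y)
      where
        by-cases : Dec (i ≡ x) → Dec (i ≡ y) → Balanced (adj G x y) (ends x y i) i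
        by-cases (yes i≡x) (yes i≡y) = ⊥-elim (x≢y (trans (sym i≡x) i≡y))
        by-cases (yes i≡x) (no _)    =
          subst (λ v → Balanced (adj G x y) (ends x y v) v) (sym i≡x)
                (subst (λ e → Balanced (adj G x y) e x) (sym (cong₂ _+_ (δ-refl x) (δ-≢ x≢y)))
                       (balanced-endpoint x y (λ j j≢y → toggle-adj-≢ (inj₂ j≢y) (inj₁ x≢y)) refl toggle-adj-xy))
        by-cases (no _)    (yes i≡y) =
          subst (λ v → Balanced (adj G x y) (ends x y v) v) (sym i≡y)
                (subst (λ e → Balanced (adj G x y) e y) (sym (cong₂ _+_ (δ-≢ (≢-sym x≢y)) (δ-refl y)))
                       (balanced-endpoint y x (λ j j≢x → toggle-adj-≢ (inj₁ (≢-sym x≢y)) (inj₂ j≢x))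
                                          (adj-sym G y x) toggle-adj-yx))
        by-cases (no i≢x)  (no i≢y)  =
          subst (λ e → Balanced (adj G x y) e i) (sym (cong₂ _+_ (δ-≢ i≢x) (δ-≢ i≢y)))
                (cong (_+ (if adj G x y then 0 else 0)) (trans (degree-∑ H i) (trans same-row (sym (degree-∑ G i)))))
          where
            same-row : sum (row H i) ≡ sum (row G i)
            same-row = sum-cong-≗ {n} (λ j → cong b2n (toggle-adj-≢ (inj₁ i≢x) (inj₁ i≢y)))

  degree-toggle-add : adj G x y ≡ false → ∀ i → degree (toggle G x≢y) i ≡ degree G i + ends x y i
  degree-toggle-add x≁y i = trans (sym (+-identityʳ _)) (subst (λ c → Balanced c (ends x y i) i) x≁y (balanced i))

  degree-toggle-remove : adj G x y ≡ true → ∀ i → degree (toggle G x≢y) i + ends x y i ≡ degree G i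
  degree-toggle-remove x∼y i = trans (subst (λ c → Balanced c (ends x y i) i) x∼y (balanced i)) (+-identityʳ _)

false≢true : false ≢ true
false≢true ()

degree+1 : ∀ {n} (G : SimpleGraph n) x → sum (λ j → row G x j + δ x j) ≡ degree G x + 1
degree+1 G x = trans (∑-distrib-+ (row G x) (δ x)) (cong₂ _+_ (sym (degree-∑ G x)) (sum-δ x))

∃-non-neighbour : ∀ {n} (G : SimpleGraph n) x → degree G x + 2 ≤ n → ∃[ u ] u ≢ x × adj G x u ≡ false
∃-non-neighbour {n} G x room =
  let u , ¬P = ¬∀⟶∃¬ n _ (λ u → (u Fin.≟ x) ⊎-dec (adj G x u Bool.≟ true)) all-adjacent
  in  u , (λ u≡x → ¬P (inj₁ u≡x)) , ¬-not (λ x∼u → ¬P (inj₂ x∼u))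
  where
    all-adjacent : ¬ (∀ u → u ≡ x ⊎ adj G x u ≡ true)
    all-adjacent P = 1+n≰n (+-cancelˡ-≤ (degree G x) 2 1 (≤-trans room (begin
      n                                   ≡⟨ *-identityʳ n ⟨
      n * 1                               ≡⟨ sum-const n 1 ⟨
      ∑[ u < n ] 1                        ≤⟨ sum-mono-≤ (λ u → counted (P u)) ⟩
      sum (λ u → row G x u + δ x u)       ≡⟨ degree+1 G x ⟩
      degree G x + 1                      ∎)))
      where
        open ≤-Reasoning
        counted : ∀ {u} → u ≡ x ⊎ adj G x u ≡ true → 1 ≤ row G x u + δ x u
        counted (inj₁ refl) = ≤-trans (≤-reflexive (sym (δ-refl x))) (m≤n+m _ _)
        counted (inj₂ x∼u)  = ≤-trans (≤-reflexive (sym (cong b2n x∼u))) (m≤m+n _ _)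

-- If N(u) ⊆ N(y) ∪ {y} while x ∈ N(y) ∖ N(u), then deg u ≤ deg y.
∃-private-neighbour : ∀ {n} (G : SimpleGraph n) {x y u} → x ≢ y → adj G y x ≡ true → adj G u x ≡ false →
                      degree G y < degree G u → ∃[ w ] adj G u w ≡ true × w ≢ y × adj G y w ≡ false
∃-private-neighbour {n} G {x} {y} {u} x≢y y∼x u≁x y<u =
  let w , ¬Q = ¬∀⟶∃¬ n Q (λ w → (adj G u w Bool.≟ false) ⊎-dec ((w Fin.≟ y) ⊎-dec (adj G y w Bool.≟ true))) dominated
  in  w , ¬-not (λ u≁w → ¬Q (inj₁ u≁w)) , (λ w≡y → ¬Q (inj₂ (inj₁ w≡y))) , ¬-not (λ y∼w → ¬Q (inj₂ (inj₂ y∼w)))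
  where
    Q : Fin n → Set
    Q w = adj G u w ≡ false ⊎ (w ≡ y ⊎ adj G y w ≡ true)
    dominated : ¬ (∀ w → Q w)
    dominated all-Q = <⇒≱ y<u (+-cancelʳ-≤ 1 _ _ (begin
      degree G u + 1                      ≡⟨ trans (∑-distrib-+ (row G u) (δ x)) (cong₂ _+_ (sym (degree-∑ G u)) (sum-δ x)) ⟨
      sum (λ w → row G u w + δ x w)       ≤⟨ sum-mono-≤ pt ⟩
      sum (λ w → row G y w + δ y w)       ≡⟨ degree+1 G y ⟩
      degree G y + 1                      ∎))
      where
        open ≤-Reasoning
        bounded : ∀ {w} → Q w → row G u w ≤ row G y w + δ y w
        bounded (inj₁ u≁w)        = ≤-trans (≤-reflexive (cong b2n u≁w)) z≤n
        bounded (inj₂ (inj₁ refl)) = ≤-trans (b2n≤1 _) (≤-trans (≤-reflexive (sym (δ-refl y))) (m≤n+m _ _))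
        bounded (inj₂ (inj₂ y∼w)) = ≤-trans (b2n≤1 _) (≤-trans (≤-reflexive (sym (cong b2n y∼w))) (m≤m+n _ _))
        pt : ∀ w → row G u w + δ x w ≤ row G y w + δ y w
        pt w with w Fin.≟ x
        ... | yes refl = subst₂ _≤_ (sym (cong (_+ 1) (cong b2n u≁x))) (sym (cong₂ _+_ (cong b2n y∼x) (δ-≢ x≢y))) ≤-refl
        ... | no _     = ≤-trans (≤-reflexive (+-identityʳ _)) (bounded (all-Q w))

switch-degrees : ∀ {n} (G : SimpleGraph n) {x y u w : Fin n} → x ≢ y → u ≢ x → u ≢ y → w ≢ y →
                 adj G u w ≡ true → adj G x u ≡ false → adj G y w ≡ false →
                 Σ[ H ∈ SimpleGraph n ] ∀ i → degree H i ≡ degree G i + ends x y i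
switch-degrees G {x} {y} {u} {w} x≢y u≢x u≢y w≢y u∼w x≁u y≁w = G₃ , degree-G₃
  where
    u≢w : u ≢ w
    u≢w u≡w = false≢true (trans (sym (loopless G u)) (trans (cong (adj G u) u≡w) u∼w))
    x≢w : x ≢ w
    x≢w x≡w = false≢true (trans (sym x≁u) (trans (adj-sym G x u) (trans (cong (adj G u) x≡w) u∼w)))
    G₁ G₂ G₃ : SimpleGraph _
    G₁ = toggle G u≢w
    G₂ = toggle G₁ (≢-sym u≢x)
    G₃ = toggle G₂ (≢-sym w≢y)
    x≁₁u : adj G₁ x u ≡ false
    x≁₁u = trans (toggle-adj-≢ G u≢w (inj₁ (≢-sym u≢x)) (inj₁ x≢w)) x≁u
    y≁₂w : adj G₂ y w ≡ false
    y≁₂w = trans (toggle-adj-≢ G₁ (≢-sym u≢x) (inj₁ (≢-sym x≢y)) (inj₁ (≢-sym u≢y)))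
                 (trans (toggle-adj-≢ G u≢w (inj₁ (≢-sym u≢y)) (inj₁ (≢-sym w≢y))) y≁w)
    degree-G₃ : ∀ i → degree G₃ i ≡ degree G i + ends x y i
    degree-G₃ i = begin
      degree G₃ i                                ≡⟨ degree-toggle-add G₂ (≢-sym w≢y) y≁₂w i ⟩
      degree G₂ i + ends y w i                   ≡⟨ cong (_+ ends y w i) (degree-toggle-add G₁ (≢-sym u≢x) x≁₁u i) ⟩
      degree G₁ i + ends x u i + ends y w i      ≡⟨ regroup (degree G₁ i) (δ x i) (δ u i) (δ y i) (δ w i) ⟩
      degree G₁ i + ends u w i + ends x y i      ≡⟨ cong (_+ ends x y i) (degree-toggle-remove G u≢w u∼w i) ⟩
      degree G i + ends x y i                    ∎
      where
        open ≡-Reasoning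
        regroup : ∀ a b c d e → a + (b + c) + (d + e) ≡ a + (c + e) + (b + d)
        regroup = solve-∀

-- If x ∼ y already, switch through a non-neighbour u of x and a neighbour w of u that y misses.
raise-pair : ∀ {n} (G : SimpleGraph n) {x y : Fin n} (x≢y : x ≢ y) → degree G x + 2 ≤ n →
             (∀ u → u ≢ x → u ≢ y → degree G y < degree G u) →
             Σ[ H ∈ SimpleGraph n ] ∀ i → degree H i ≡ degree G i + ends x y i
raise-pair G {x} {y} x≢y room y-smallest with adj G x y in x∼y?
... | false = toggle G x≢y , degree-toggle-add G x≢y x∼y?
... | true  =
  let u , u≢x , x≁u = ∃-non-neighbour G x room
      u≢y : _ ≢ y
      u≢y = λ u≡y → false≢true (trans (sym x≁u) (trans (cong (adj G x) u≡y) x∼y?))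
      w , u∼w , w≢y , y≁w = ∃-private-neighbour G x≢y (trans (adj-sym G y x) x∼y?) (trans (adj-sym G u x) x≁u)
                                                (y-smallest u u≢x u≢y)
  in  switch-degrees G x≢y u≢x u≢y w≢y u∼w x≁u y≁w

emptyGraph : ∀ n → SimpleGraph n
emptyGraph n = record { adj = λ _ _ → false ; adj-sym = λ _ _ → refl ; loopless = λ _ → refl }

extend : ∀ {n} → SimpleGraph n → SimpleGraph (suc n)
extend {n} G = record { adj = adj′ ; adj-sym = adj′-sym ; loopless = adj′-loopless }
  where
    adj′ : Fin (suc n) → Fin (suc n) → Bool
    adj′ i j with toℕ i <? n | toℕ j <? n
    ... | yes i<n | yes j<n = adj G (fromℕ< i<n) (fromℕ< j<n)
    ... | _       | _       = false
    adj′-sym : ∀ i j → adj′ i j ≡ adj′ j i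
    adj′-sym i j with toℕ i <? n | toℕ j <? n
    ... | yes _ | yes _ = adj-sym G _ _
    ... | yes _ | no _  = refl
    ... | no _  | yes _ = refl
    ... | no _  | no _  = refl
    adj′-loopless : ∀ i → adj′ i i ≡ false
    adj′-loopless i with toℕ i <? n
    ... | yes _ = loopless G _
    ... | no _  = refl

module _ {n} (G : SimpleGraph n) where

  extend-adj-< : ∀ (i : Fin (suc n)) (i<n : toℕ i < n) j → adj (extend G) i (Fin.inject₁ j) ≡ adj G (fromℕ< i<n) j
  extend-adj-< i i<n j with toℕ i <? n | toℕ (Fin.inject₁ j) <? n
  ... | yes i<n′ | yes j<n = cong₂ (adj G) (toℕ-injective (trans (toℕ-fromℕ< i<n′) (sym (toℕ-fromℕ< i<n))))
                                          (toℕ-injective (trans (toℕ-fromℕ< j<n) (toℕ-inject₁ j)))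
  ... | no i≮n   | _      = ⊥-elim (i≮n i<n)
  ... | yes _    | no j≮n = ⊥-elim (j≮n (subst (_< n) (sym (toℕ-inject₁ j)) (toℕ<n j)))

  extend-adj-last : ∀ i → adj (extend G) i (Fin.fromℕ n) ≡ false
  extend-adj-last i with toℕ i <? n | toℕ (Fin.fromℕ n) <? n
  ... | yes _ | yes n<n = ⊥-elim (<-irrefl (toℕ-fromℕ n) n<n)
  ... | yes _ | no _    = refl
  ... | no _  | _       = refl

  extend-adj-≥ : ∀ i j → ¬ toℕ i < n → adj (extend G) i j ≡ false
  extend-adj-≥ i j i≮n with toℕ i <? n
  ... | yes i<n = ⊥-elim (i≮n i<n)
  ... | no _    = refl

  degree-extend-< : ∀ (i : Fin (suc n)) (i<n : toℕ i < n) → degree (extend G) i ≡ degree G (fromℕ< i<n)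
  degree-extend-< i i<n = begin
    degree (extend G) i                                                  ≡⟨ degree-∑ (extend G) i ⟩
    sum (row (extend G) i)                                               ≡⟨ sum-init-last (row (extend G) i) ⟩
    sum (row (extend G) i ∘ Fin.inject₁) + row (extend G) i (Fin.fromℕ n) ≡⟨ cong₂ _+_ (sum-cong-≗ (cong b2n ∘ extend-adj-< i i<n))
                                                                                          (cong b2n (extend-adj-last i)) ⟩
    sum (row G (fromℕ< i<n)) + 0                                         ≡⟨ +-identityʳ _ ⟩
    sum (row G (fromℕ< i<n))                                             ≡⟨ degree-∑ G (fromℕ< i<n) ⟨
    degree G (fromℕ< i<n)                                                ∎
    where open ≡-Reasoning

  degree-extend-≥ : ∀ (i : Fin (suc n)) → ¬ toℕ i < n → degree (extend G) i ≡ 0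
  degree-extend-≥ i i≮n = trans (degree-∑ (extend G) i) (sum-≡0 (λ j → cong b2n (extend-adj-≥ i j i≮n)))

Realisation : ℕ → (ℕ → ℕ) → Set
Realisation n d = Σ[ G ∈ SimpleGraph n ] ∀ i → degree G i ≡ d (toℕ i)

realisation-extend : ∀ n d → d n ≡ 0 → Realisation n d → Realisation (suc n) d
realisation-extend n d d-n≡0 (G , degree-G) = extend G , degree-extend
  where
    degree-extend : ∀ i → degree (extend G) i ≡ d (toℕ i)
    degree-extend i = by-cases (toℕ i <? n)
      where
        by-cases : Dec (toℕ i < n) → degree (extend G) i ≡ d (toℕ i)
        by-cases (yes i<n) = trans (degree-extend-< G i i<n) (trans (degree-G (fromℕ< i<n)) (cong d (toℕ-fromℕ< i<n)))
        by-cases (no i≮n)  = trans (degree-extend-≥ G i i≮n)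
                                   (trans (sym d-n≡0) (cong d (sym (≤-antisym (≤-pred (toℕ<n i)) (≮⇒≥ i≮n)))))

-- Erdős–Gallai sufficiency

module Lowering (m : ℕ) (d : ℕ → ℕ) (t : ℕ)
  (antitone : Antitone (suc m) d) (eg : ErdősGallai (suc m) d) (even : Even (sumBelow (suc m) d))
  (1≤d-m : 1 ≤ d m) (t<m : t < m)
  (block : ∀ j → j ≤ t → d j ≡ d 0) (block-end : d (suc t) < d 0 ⊎ suc t ≡ m) where

  n : ℕ
  n = suc m

  D : ℕ
  D = d 0

  g : ℕ → ℕ
  g = lower m d

  d′ : ℕ → ℕ
  d′ = lower t g

  t≢m : t ≢ m
  t≢m = <⇒≢ t<m

  t<n : t < n
  t<n = m<n⇒m<1+n t<m

  g-t : g t ≡ D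
  g-t = trans (lower-≢ m d t≢m) (block t ≤-refl)

  1≤D : 1 ≤ D
  1≤D = ≤-trans 1≤d-m (antitone 0 m z≤n (n<1+n m))

  1≤g-t : 1 ≤ g t
  1≤g-t = ≤-trans 1≤D (≤-reflexive (sym g-t))

  d′-t : d′ t ≡ pred D
  d′-t = trans (lower-≡ t g) (cong pred g-t)

  d′-m : d′ m ≡ pred (d m)
  d′-m = trans (lower-≢ t g (≢-sym t≢m)) (lower-≡ m d)

  d′-≢ : ∀ {j} → j ≢ t → j ≢ m → d′ j ≡ d j
  d′-≢ j≢t j≢m = trans (lower-≢ t g j≢t) (lower-≢ m d j≢m)

  sum-d′ : 2 + sumBelow n d′ ≡ sumBelow n d
  sum-d′ = trans (cong suc (sumBelow-lower n t g t<n 1≤g-t)) (sumBelow-lower n m d (n<1+n m) 1≤d-m)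

  g-m<g-t : g m < g t
  g-m<g-t = begin-strict
    g m          ≡⟨ lower-≡ m d ⟩
    pred (d m)   <⟨ ≤-reflexive (suc-pred (d m) ⦃ >-nonZero 1≤d-m ⦄) ⟩
    d m          ≤⟨ antitone 0 m z≤n (n<1+n m) ⟩
    D            ≡⟨ g-t ⟨
    g t          ∎
    where open ≤-Reasoning

  antitone-d′ : Antitone n d′
  antitone-d′ = lower-antitone n t g antitone-g drop
    where
      antitone-g : Antitone n g
      antitone-g = lower-antitone n m d antitone (λ m+1<n → ⊥-elim (<-irrefl refl m+1<n))
      drop : suc t < n → g (suc t) < g t
      drop = drop′ block-end
        where
          drop′ : d (suc t) < D ⊎ suc t ≡ m → suc t < n → g (suc t) < g t
          drop′ (inj₁ d-t+1<D) _ = ≤-<-trans (lower-≤ m d (suc t)) (subst (d (suc t) <_) (sym g-t) d-t+1<D)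
          drop′ (inj₂ t+1≡m) _ = subst (λ x → g x < g t) (sym t+1≡m) g-m<g-t

  prefix-block : ∀ k → k ≤ suc t → sumBelow k d ≡ k * D
  prefix-block k k≤t+1 = trans (sumBelow-cong k (λ j j<k → block j (≤-pred (≤-trans j<k k≤t+1)))) (sumBelow-const k D)

  prefix-d′ : ∀ k → k ≤ t → sumBelow k d′ ≡ sumBelow k d
  prefix-d′ k k≤t = trans (sumBelow-lower-≥ k t g k≤t) (sumBelow-lower-≥ k m d (≤-trans k≤t (<⇒≤ t<m)))

  erdősGallai-past-block : ∀ k → k ≤ n → t < k → sumBelow k d′ ≤ k * (k ∸ 1) + tailMin n k d′
  erdősGallai-past-block k k≤n t<k = ≤-pred (begin
    suc (sumBelow k d′)                   ≡⟨ sumBelow-lower k t g t<k 1≤g-t ⟩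
    sumBelow k g                          ≤⟨ sumBelow-mono-≤ k (λ j _ → lower-≤ m d j) ⟩
    sumBelow k d                          ≤⟨ eg k k≤n ⟩
    k * (k ∸ 1) + tailMin n k d           ≤⟨ +-monoʳ-≤ (k * (k ∸ 1)) (tailMin-lower n k m d) ⟩
    k * (k ∸ 1) + suc (tailMin n k g)     ≡⟨ +-suc _ _ ⟩
    suc (k * (k ∸ 1) + tailMin n k g)     ≡⟨ cong (λ x → suc (k * (k ∸ 1) + x)) (tailMin-lower-< n k t g t<k) ⟨
    suc (k * (k ∸ 1) + tailMin n k d′)    ∎)
    where open ≤-Reasoning

  -- Otherwise ∑ d = (t + 1) t + 1 would be odd.
  2≤d-m : suc t ≡ m → D ≡ t → 2 ≤ d m
  2≤d-m t+1≡m D≡t with 2 ≤? d m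
  ... | yes 2≤d-m = 2≤d-m
  ... | no 2≰d-m = ⊥-elim (even≢odd (proj₁ even) h (trans (sym (proj₂ even)) odd-sum))
    where
      h : ℕ
      h = proj₁ (Even-*-suc t)
      odd-sum : sumBelow n d ≡ suc (2 * h)
      odd-sum = begin
        sumBelow (suc m) d      ≡⟨ sumBelow-snoc m d ⟩
        sumBelow m d + d m      ≡⟨ cong₂ _+_ (trans (cong (λ x → sumBelow x d) (sym t+1≡m)) (prefix-block (suc t) ≤-refl))
                                             (≤-antisym (≤-pred (≰⇒> 2≰d-m)) 1≤d-m) ⟩
        suc t * D + 1           ≡⟨ cong (λ x → suc t * x + 1) D≡t ⟩
        suc t * t + 1           ≡⟨ +-comm _ 1 ⟩
        suc (suc t * t)         ≡⟨ cong suc (*-comm (suc t) t) ⟩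
        suc (t * suc t)         ≡⟨ cong suc (proj₂ (Even-*-suc t)) ⟩
        suc (2 * h)             ∎
        where open ≡-Reasoning

  tailMin-block : ∀ k → 1 ≤ k → k ≤ t → D ≡ k → k ≤ tailMin n k d′
  tailMin-block k 1≤k k≤t D≡k rewrite tailMin-unfold n k d′ (≤-<-trans k≤t t<n) with k ≟ t
  ... | no k≢t = ≤-trans (≤-reflexive (sym at-k)) (m≤m+n _ _)
    where
      at-k : d′ k ⊓ k ≡ k
      at-k rewrite d′-≢ k≢t (<⇒≢ (≤-<-trans k≤t t<m)) | block k k≤t | D≡k = ⊓-idem k
  ... | yes refl = begin
    k                               ≡⟨ suc-pred k ⦃ >-nonZero 1≤k ⦄ ⟨
    suc (pred k)                    ≡⟨ +-comm 1 _ ⟩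
    pred k + 1                      ≤⟨ +-mono-≤ (≤-reflexive (sym at-k)) (≤-trans 1≤next (≤-sumBelow n (from (suc k) h) (s≤s t<m))) ⟩
    d′ k ⊓ k + sumBelow n (from (suc k) h) ∎
    where
      open ≤-Reasoning
      h : ℕ → ℕ
      h j = d′ j ⊓ k
      at-k : d′ k ⊓ k ≡ pred k
      at-k rewrite d′-t | D≡k = m≤n⇒m⊓n≡m pred[n]≤n
      1≤d′-next : 1 ≤ d′ (suc k)
      1≤d′-next with suc k ≟ m
      ... | no k+1≢m = subst (1 ≤_) (sym (d′-≢ (λ ()) k+1≢m))
                             (≤-trans 1≤d-m (antitone (suc k) m t<m (n<1+n m)))
      ... | yes k+1≡m = subst (λ x → 1 ≤ d′ x) (sym k+1≡m)
                              (subst (1 ≤_) (sym d′-m) (<⇒≤pred (2≤d-m k+1≡m D≡k)))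
      1≤next : 1 ≤ from (suc k) h (suc k)
      1≤next = subst (1 ≤_) (sym (from-≥ h (≤-refl {suc k}))) (⊓-glb 1≤d′-next 1≤k)

  module InsideBlock (k : ℕ) (k≤t : k ≤ t) (k<D : k < D) where

    k<m : k < m
    k<m = ≤-<-trans k≤t t<m

    y c : ℕ → ℕ
    y = from (suc k) (λ j → d j ⊓ k)
    c = from (suc k) (λ j → b2n (k <ᵇ d j))

    Y C : ℕ
    Y = sumBelow n y
    C = sumBelow n c

    tailMin-k : tailMin n k d ≡ k + Y
    tailMin-k = trans (tailMin-unfold n k d (m<n⇒m<1+n k<m))
                      (cong (_+ Y) (trans (cong (_⊓ k) (block k k≤t)) (m≥n⇒m⊓n≡n (<⇒≤ k<D))))

    erdősGallai-suc-k : suc k * D ≤ suc k * k + (Y + C)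
    erdősGallai-suc-k = begin
      suc k * D                         ≡⟨ prefix-block (suc k) (s≤s k≤t) ⟨
      sumBelow (suc k) d                ≤⟨ eg (suc k) (s≤s (<⇒≤ k<m)) ⟩
      suc k * k + tailMin n (suc k) d   ≡⟨ cong (suc k * k +_) (tailMin-suc n k d) ⟩
      suc k * k + (Y + C)               ∎
      where open ≤-Reasoning

    -- Every index counted by C contributes k to Y, and the last vertex contributes d m > 0 to Y only.
    k*C<Y : d m ≤ k → suc (k * C) ≤ Y
    k*C<Y d-m≤k = begin
      suc (k * C)                                               ≡⟨ cong₂ _+_ (sumBelow-at n m (λ _ → 1) (n<1+n m)) (sumBelow-* n k c) ⟨
      sumBelow n (at m (λ _ → 1)) + sumBelow n (λ j → k * c j)  ≡⟨ sumBelow-+ n (at m (λ _ → 1)) (λ j → k * c j) ⟨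
      sumBelow n (λ j → at m (λ _ → 1) j + k * c j)             ≤⟨ sumBelow-mono-≤ n (λ j _ → pt j) ⟩
      Y                                                         ∎
      where
        open ≤-Reasoning
        pt : ∀ j → at m (λ _ → 1) j + k * c j ≤ y j
        pt j with j ≟ m
        ... | yes refl rewrite ≡ᵇ-refl j | <ᵇ-false {j} {suc k} k<m | <ᵇ-false {k} {d j} d-m≤k
                             | *-zeroʳ k | m≤n⇒m⊓n≡m d-m≤k = 1≤d-m
        ... | no j≢m rewrite ≡ᵇ-false j≢m with j <ᵇ suc k
        ...   | true rewrite *-zeroʳ k = z≤n
        ...   | false with k <ᵇ d j in k<ᵇd-j
        ...     | true rewrite *-identityʳ k = ≤-reflexive (sym (m≥n⇒m⊓n≡n (<⇒≤ (<ᵇ-true⇒< k<ᵇd-j))))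
        ...     | false rewrite *-zeroʳ k = z≤n

  erdősGallai-inside-block : ∀ k′ → suc k′ ≤ t → suc k′ < D →
                             sumBelow (suc k′) d′ ≤ suc k′ * k′ + tailMin n (suc k′) d′
  erdősGallai-inside-block k′ k≤t k<D with suc (suc k′) ≤? d m
  ... | yes k<d-m = begin
    sumBelow k d′             ≡⟨ prefix-d′ k k≤t ⟩
    sumBelow k d              ≤⟨ eg k (≤-trans k≤t (<⇒≤ t<n)) ⟩
    k * k′ + tailMin n k d    ≡⟨ cong (k * k′ +_) (tailMin-lower-> n k m d k<d-m) ⟨
    k * k′ + tailMin n k g    ≡⟨ cong (k * k′ +_) (tailMin-lower-> n k t g (subst (k <_) (sym g-t) k<D)) ⟨
    k * k′ + tailMin n k d′   ∎
    where
      open ≤-Reasoning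
      k = suc k′
  ... | no k≮d-m = ≤-pred (begin
    suc (sumBelow k d′)            ≡⟨ cong suc (trans (prefix-d′ k k≤t) (prefix-block k (m≤n⇒m≤1+n k≤t))) ⟩
    suc (k * D)                    ≤⟨ scale-down-bound k D Y C erdősGallai-suc-k (k*C<Y (≤-pred (≰⇒> k≮d-m))) ⟩
    k * k + Y                      ≡⟨ split k′ Y ⟩
    k * k′ + (k + Y)               ≡⟨ cong (k * k′ +_) tailMin-k ⟨
    k * k′ + tailMin n k d         ≤⟨ +-monoʳ-≤ (k * k′) (tailMin-lower n k m d) ⟩
    k * k′ + suc (tailMin n k g)   ≡⟨ +-suc _ _ ⟩
    suc (k * k′ + tailMin n k g)   ≡⟨ cong (λ x → suc (k * k′ + x)) (tailMin-lower-> n k t g (subst (k <_) (sym g-t) k<D)) ⟨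
    suc (k * k′ + tailMin n k d′)  ∎)
    where
      open ≤-Reasoning
      k = suc k′
      open InsideBlock k k≤t k<D
      split : ∀ k′ Y → suc k′ * suc k′ + Y ≡ suc k′ * k′ + (suc k′ + Y)
      split = solve-∀

  erdősGallai-d′ : ErdősGallai n d′
  erdősGallai-d′ zero _ = z≤n
  erdősGallai-d′ (suc k′) k≤n with t <? suc k′
  ... | yes t<k = erdősGallai-past-block (suc k′) k≤n t<k
  ... | no t≮k with <-cmp D (suc k′)
  ...   | tri> _ _ k<D = erdősGallai-inside-block k′ (≮⇒≥ t≮k) k<D
  ...   | tri< D<k _ _ = begin
    sumBelow k d′             ≡⟨ trans (prefix-d′ k (≮⇒≥ t≮k)) (prefix-block k (m≤n⇒m≤1+n (≮⇒≥ t≮k))) ⟩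
    k * D                     ≤⟨ *-monoʳ-≤ k (≤-pred D<k) ⟩
    k * k′                    ≤⟨ m≤m+n _ _ ⟩
    k * k′ + tailMin n k d′   ∎
    where
      open ≤-Reasoning
      k = suc k′
  ...   | tri≈ _ D≡k _ = begin
    sumBelow k d′             ≡⟨ trans (prefix-d′ k (≮⇒≥ t≮k)) (prefix-block k (m≤n⇒m≤1+n (≮⇒≥ t≮k))) ⟩
    k * D                     ≡⟨ cong (k *_) D≡k ⟩
    k * k                     ≡⟨ *-suc k k′ ⟩
    k + k * k′                ≡⟨ +-comm k (k * k′) ⟩
    k * k′ + k                ≤⟨ +-monoʳ-≤ (k * k′) (tailMin-block k (s≤s z≤n) (≮⇒≥ t≮k) D≡k) ⟩
    k * k′ + tailMin n k d′   ∎
    where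
      open ≤-Reasoning
      k = suc k′

  D≤m : D ≤ m
  D≤m = begin
    D                                ≡⟨ +-identityʳ D ⟨
    sumBelow 1 d                     ≤⟨ eg 1 (s≤s z≤n) ⟩
    tailMin n 1 d                    ≤⟨ sumBelow-mono-≤ n (λ j _ → pt j) ⟩
    sumBelow n (from 1 (λ _ → 1))    ≡⟨ sumBelow-from-const n 1 1 ⟩
    m * 1                            ≡⟨ *-identityʳ m ⟩
    m                                ∎
    where
      open ≤-Reasoning
      pt : ∀ j → from 1 (λ j → d j ⊓ 1) j ≤ from 1 (λ _ → 1) j
      pt j with j <ᵇ 1
      ... | true  = z≤n
      ... | false = m⊓n≤n (d j) 1

  realisation-lift : Realisation n d′ → Realisation n d
  realisation-lift (G , degree-G) = H , degree-H
    where
      t′ m′ : Fin n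
      t′ = fromℕ< t<n
      m′ = fromℕ< (n<1+n m)
      t′≢m′ : t′ ≢ m′
      t′≢m′ t′≡m′ = t≢m (trans (sym (toℕ-fromℕ< t<n)) (trans (cong toℕ t′≡m′) (toℕ-fromℕ< (n<1+n m))))
      degree-G-fromℕ< : ∀ {p} (p<n : p < n) → degree G (fromℕ< p<n) ≡ d′ p
      degree-G-fromℕ< p<n = trans (degree-G (fromℕ< p<n)) (cong d′ (toℕ-fromℕ< p<n))
      room : degree G t′ + 2 ≤ n
      room = begin
        degree G t′ + 2     ≡⟨ cong (_+ 2) (trans (degree-G-fromℕ< t<n) d′-t) ⟩
        pred D + 2          ≡⟨ +-comm (pred D) 2 ⟩
        suc (suc (pred D))  ≡⟨ cong suc (suc-pred D ⦃ >-nonZero 1≤D ⦄) ⟩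
        suc D               ≤⟨ s≤s D≤m ⟩
        n                   ∎
        where open ≤-Reasoning
      toℕ-≢ : ∀ {p} (p<n : p < n) {u} → u ≢ fromℕ< p<n → toℕ u ≢ p
      toℕ-≢ p<n u≢p toℕu≡p = u≢p (toℕ-injective (trans toℕu≡p (sym (toℕ-fromℕ< p<n))))
      m′-smallest : ∀ u → u ≢ t′ → u ≢ m′ → degree G m′ < degree G u
      m′-smallest u u≢t′ u≢m′ = begin-strict
        degree G m′   ≡⟨ trans (degree-G-fromℕ< (n<1+n m)) d′-m ⟩
        pred (d m)    <⟨ ≤-reflexive (suc-pred (d m) ⦃ >-nonZero 1≤d-m ⦄) ⟩
        d m           ≤⟨ antitone (toℕ u) m (≤-pred (toℕ<n u)) (n<1+n m) ⟩
        d (toℕ u)     ≡⟨ d′-≢ (toℕ-≢ t<n u≢t′) (toℕ-≢ (n<1+n m) u≢m′) ⟨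
        d′ (toℕ u)    ≡⟨ degree-G u ⟨
        degree G u    ∎
        where open ≤-Reasoning
      raised = raise-pair G t′≢m′ room m′-smallest
      H = proj₁ raised
      degree-H : ∀ i → degree H i ≡ d (toℕ i)
      degree-H i = begin
        degree H i                                             ≡⟨ proj₂ raised i ⟩
        degree G i + (δ t′ i + δ m′ i)                         ≡⟨ +-assoc (degree G i) _ _ ⟨
        degree G i + δ t′ i + δ m′ i                           ≡⟨ cong₂ (λ a b → a + b + δ m′ i) (degree-G i) (δ-fromℕ< t<n i) ⟩
        d′ (toℕ i) + at t (λ _ → 1) (toℕ i) + δ m′ i           ≡⟨ cong₂ _+_ (lower-+-at t g (toℕ i) 1≤g-t) (δ-fromℕ< (n<1+n m) i) ⟩
        g (toℕ i) + at m (λ _ → 1) (toℕ i)                     ≡⟨ lower-+-at m d (toℕ i) 1≤d-m ⟩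
        d (toℕ i)                                              ∎
        where open ≡-Reasoning

maximal-block : ∀ m d → Antitone (suc m) d → 1 ≤ m →
                Σ[ t ∈ ℕ ] t < m × (∀ j → j ≤ t → d j ≡ d 0) × (d (suc t) < d 0 ⊎ suc t ≡ m)
maximal-block m d antitone 1≤m = extend-block (m ∸ 1) 0 (trans (+-comm (m ∸ 1) 1) (m+[n∸m]≡n 1≤m)) (λ { zero _ → refl })
  where
    extend-block : ∀ r i → r + suc i ≡ m → (∀ j → j ≤ i → d j ≡ d 0) →
                   Σ[ t ∈ ℕ ] t < m × (∀ j → j ≤ t → d j ≡ d 0) × (d (suc t) < d 0 ⊎ suc t ≡ m)
    extend-block zero    i eq block = i , ≤-reflexive eq , block , inj₂ eq
    extend-block (suc r) i eq block with d (suc i) <? d 0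
    ... | yes drop = i , ≤-trans (m≤n+m (suc i) (suc r)) (≤-reflexive eq) , block , inj₁ drop
    ... | no no-drop = extend-block r (suc i) (trans (+-suc r (suc i)) eq) block′
      where
        block′ : ∀ j → j ≤ suc i → d j ≡ d 0
        block′ j j≤i+1 with j ≟ suc i
        ... | yes refl = ≤-antisym (antitone 0 (suc i) z≤n (s≤s (≤-trans (m≤n+m (suc i) (suc r)) (≤-reflexive eq)))) (≮⇒≥ no-drop)
        ... | no j≢i+1 = block j (≤-pred (≤∧≢⇒< j≤i+1 j≢i+1))

erdősGallai-init : ∀ m d → d m ≡ 0 → ErdősGallai (suc m) d → ErdősGallai m d
erdősGallai-init m d d-m≡0 eg k k≤m = ≤-trans (eg k (m≤n⇒m≤1+n k≤m)) (≤-reflexive (cong (k * (k ∸ 1) +_) tail≡))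
  where
    tail≡ : tailMin (suc m) k d ≡ tailMin m k d
    tail≡ = trans (sumBelow-snoc m (from k (λ j → d j ⊓ k)))
                  (trans (cong (tailMin m k d +_) last≡0) (+-identityʳ _))
      where
        last≡0 : from k (λ j → d j ⊓ k) m ≡ 0
        last≡0 with m <ᵇ k
        ... | true  = refl
        ... | false rewrite d-m≡0 = refl

-- Well-founded on n + ∑ d: each step either drops a vertex or lowers the degree sum by two.
erdősGallai⇒realisation : ∀ n d → Acc _<_ (n + sumBelow n d) →
                          Antitone n d → Even (sumBelow n d) → ErdősGallai n d → Realisation n d
erdősGallai⇒realisation zero d _ _ _ _ = emptyGraph 0 , λ ()
erdősGallai⇒realisation (suc m) d (acc rec) antitone even eg with d m ≟ 0
... | yes d-m≡0 = realisation-extend m d d-m≡0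
  (erdősGallai⇒realisation m d (rec smaller) (λ i j i≤j j<m → antitone i j i≤j (m<n⇒m<1+n j<m))
                           (proj₁ even , trans (sym sum≡) (proj₂ even)) (erdősGallai-init m d d-m≡0 eg))
  where
    sum≡ : sumBelow (suc m) d ≡ sumBelow m d
    sum≡ = trans (sumBelow-snoc m d) (trans (cong (sumBelow m d +_) d-m≡0) (+-identityʳ _))
    smaller : m + sumBelow m d < suc m + sumBelow (suc m) d
    smaller = s≤s (≤-reflexive (cong (m +_) (sym sum≡)))
erdősGallai⇒realisation (suc zero) d _ _ _ eg | no d-0≢0 =
  ⊥-elim (d-0≢0 (n≤0⇒n≡0 (≤-trans (≤-reflexive (sym (+-identityʳ (d 0)))) (eg 1 ≤-refl))))
erdősGallai⇒realisation (suc (suc m′)) d (acc rec) antitone even eg | no d-m≢0 =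
  let t , t<m , block , block-end = maximal-block m d antitone (s≤s z≤n)
      open Lowering m d t antitone eg even (n≢0⇒n>0 d-m≢0) t<m block block-end
  in realisation-lift (erdősGallai⇒realisation n d′ (rec (smaller sum-d′)) antitone-d′
                                               (Even-2+ (sumBelow n d′) (proj₁ even , trans sum-d′ (proj₂ even)))
                                               erdősGallai-d′)
  where
    m = suc m′
    smaller : ∀ {s s′} → 2 + s′ ≡ s → suc m + s′ < suc m + s
    smaller {s′ = s′} eq = +-monoʳ-< (suc m) (≤-trans (n≤1+n (suc s′)) (≤-reflexive eq))

-- Sufficiency of the inequality

toSeq : ∀ {n} → (Fin n → ℕ) → ℕ → ℕ
toSeq {n} d x with x <? n
... | yes x<n = d (fromℕ< x<n)
... | no _    = 0

module _ {n} (d : Fin n → ℕ) where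

  toSeq-< : ∀ {x} (x<n : x < n) → toSeq d x ≡ d (fromℕ< x<n)
  toSeq-< {x} x<n with x <? n
  ... | yes x<n′ = cong d (toℕ-injective (trans (toℕ-fromℕ< x<n′) (sym (toℕ-fromℕ< x<n))))
  ... | no x≮n   = ⊥-elim (x≮n x<n)

  toSeq-toℕ : ∀ i → toSeq d (toℕ i) ≡ d i
  toSeq-toℕ i = trans (toSeq-< (toℕ<n i)) (cong d (fromℕ<-toℕ i (toℕ<n i)))

  sumBelow-toSeq : sumBelow n (toSeq d) ≡ sumFin d
  sumBelow-toSeq = trans (sum-cong-≗ toSeq-toℕ) (sym (sumFin≡sum d))

  toSeq-antitone : Decreasing d → Antitone n (toSeq d)
  toSeq-antitone decreasing i j i≤j j<n =
    subst₂ _≤_ (sym (toSeq-< j<n)) (sym (toSeq-< (≤-<-trans i≤j j<n)))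
      (decreasing (fromℕ< (≤-<-trans i≤j j<n)) (fromℕ< j<n) (subst₂ _≤_ (sym (toℕ-fromℕ< _)) (sym (toℕ-fromℕ< j<n)) i≤j))

  realisation⇒graphic : Realisation n (toSeq d) → Graphic d
  realisation⇒graphic (G , degree-G) = G , λ i → trans (degree-G i) (toSeq-toℕ i)

*≤⌊+²/4⌋ : ∀ k q → k * q ≤ ((k + q) * (k + q)) / 4
*≤⌊+²/4⌋ k q = ≤-trans (≤-reflexive (sym (m*n/n≡m (k * q) 4))) (/-monoˡ-≤ 4 (four-kq≤square k q))
  where
    -- (k + q)² = 4kq + (q − k)²
    four-kq≤square : ∀ k q → k * q * 4 ≤ (k + q) * (k + q)
    four-kq≤square k q with ≤-total k q
    ... | inj₁ k≤q = subst (λ q → k * q * 4 ≤ (k + q) * (k + q)) (m+[n∸m]≡n k≤q)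
                           (≤-trans (m≤m+n _ ((q ∸ k) * (q ∸ k))) (≤-reflexive (expand k (q ∸ k))))
      where
        expand : ∀ k e → k * (k + e) * 4 + e * e ≡ (k + (k + e)) * (k + (k + e))
        expand = solve-∀
    ... | inj₂ q≤k = subst (λ k → k * q * 4 ≤ (k + q) * (k + q)) (m+[n∸m]≡n q≤k)
                           (≤-trans (m≤m+n _ ((k ∸ q) * (k ∸ q))) (≤-reflexive (expand q (k ∸ q))))
      where
        expand : ∀ q e → (q + e) * q * 4 + e * e ≡ (q + e + q) * (q + e + q)
        expand = solve-∀

-- With q = a + b + 1 − k this reduces to k q ≤ ⌊(k + q)²/4⌋ = base a b.
prefix-arith : ∀ a b k′ r → b < suc k′ → base a b ≤ (suc k′ + r) * b + 1 → suc k′ * a ≤ suc k′ * k′ + r * b + 1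
prefix-arith a b k′ r b<k base≤ with suc k′ ≤? a + b + 1
... | yes k≤N = +-cancelʳ-≤ (k * b + k) _ _ (begin
  k * a + (k * b + k)          ≡⟨ distrib k a b ⟩
  k * (a + b + 1)              ≡⟨ cong (k *_) k+q≡N ⟨
  k * (k + q)                  ≡⟨ *-distribˡ-+ k k q ⟩
  k * k + k * q                ≤⟨ +-monoʳ-≤ (k * k) kq≤ ⟩
  k * k + ((k + r) * b + 1)    ≡⟨ regroup k′ r b ⟩
  suc k′ * k′ + r * b + 1 + (k * b + k) ∎)
  where
    open ≤-Reasoning
    k = suc k′
    q = a + b + 1 ∸ k
    k+q≡N : k + q ≡ a + b + 1
    k+q≡N = m+[n∸m]≡n k≤N
    kq≤ : k * q ≤ (k + r) * b + 1
    kq≤ = ≤-trans (*≤⌊+²/4⌋ k q) (≤-trans (≤-reflexive (cong (λ x → (x * x) / 4) k+q≡N)) base≤)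
    distrib : ∀ k a b → k * a + (k * b + k) ≡ k * (a + b + 1)
    distrib = solve-∀
    regroup : ∀ k′ r b → suc k′ * suc k′ + ((suc k′ + r) * b + 1) ≡ suc k′ * k′ + r * b + 1 + (suc k′ * b + suc k′)
    regroup = solve-∀
... | no k≰N = ≤-trans (*-monoʳ-≤ (suc k′) a≤k′) (≤-trans (m≤m+n _ (r * b)) (m≤m+n _ 1))
  where
    a≤k′ : a ≤ k′
    a≤k′ = ≤-trans (m≤m+n a (b + 1)) (≤-trans (≤-reflexive (sym (+-assoc a b 1))) (≤-pred (≰⇒> k≰N)))

module Sufficiency {n} (d : Fin n → ℕ) {a b : ℕ}
  (decreasing : Decreasing d) (positive : Positive d) (evenSum : EvenSum d) (isMax : IsMax d a) (isMin : IsMin d b)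
  (bound : base a b ≤ n * b + 1) where

  e : ℕ → ℕ
  e = toSeq d

  e≤a : ∀ j → j < n → e j ≤ a
  e≤a j j<n = subst (_≤ a) (sym (toSeq-< d j<n)) (proj₂ isMax _)

  b≤e : ∀ j → j < n → b ≤ e j
  b≤e j j<n = subst (b ≤_) (sym (toSeq-< d j<n)) (proj₂ isMin _)

  even : Even (sumBelow n e)
  even = subst Even (sym (sumBelow-toSeq d)) (%2≡0⇒Even (sumFin d) evenSum)

  1≤b : 1 ≤ b
  1≤b = subst (1 ≤_) (proj₂ (proj₁ isMin)) (positive _)

  1≤n : 1 ≤ n
  1≤n = ≤-trans (s≤s z≤n) (toℕ<n (proj₁ (proj₁ isMax)))

  -- If n ≤ a, then a (b + 1) ≤ base a b ≤ a b + 1 forces a = n = 1, and d = (1) has odd sum.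
  a<n : a < n
  a<n with a <? n
  ... | yes a<n = a<n
  ... | no a≮n = ⊥-elim (even≢odd (proj₁ even) 0 (trans (sym (proj₂ even)) sum≡1))
    where
      a≤1 : a ≤ 1
      a≤1 = +-cancelˡ-≤ (a * b) a 1 (begin
        a * b + a                             ≡⟨ factor a b ⟩
        a * (b + 1)                           ≤⟨ *≤⌊+²/4⌋ a (b + 1) ⟩
        ((a + (b + 1)) * (a + (b + 1))) / 4   ≡⟨ cong (λ x → (x * x) / 4) (+-assoc a b 1) ⟨
        base a b                              ≤⟨ bound ⟩
        n * b + 1                             ≤⟨ +-monoˡ-≤ 1 (*-monoˡ-≤ b (≮⇒≥ a≮n)) ⟩
        a * b + 1                             ∎)
        where
          open ≤-Reasoning
          factor : ∀ a b → a * b + a ≡ a * (b + 1)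
          factor = solve-∀
      n≡1 : n ≡ 1
      n≡1 = ≤-antisym (≤-trans (≮⇒≥ a≮n) a≤1) 1≤n
      sum≡1 : sumBelow n e ≡ 1
      sum≡1 = begin
        sumBelow n e   ≡⟨ cong (λ k → sumBelow k e) n≡1 ⟩
        e 0 + 0        ≡⟨ +-identityʳ (e 0) ⟩
        e 0            ≡⟨ ≤-antisym (≤-trans (e≤a 0 1≤n) a≤1) (≤-trans 1≤b (b≤e 0 1≤n)) ⟩
        1              ∎
        where open ≡-Reasoning

  erdősGallai-≤b : ∀ k′ → suc k′ ≤ n → suc k′ ≤ b → sumBelow (suc k′) e ≤ suc k′ * k′ + tailMin n (suc k′) e
  erdősGallai-≤b k′ k≤n k≤b = begin
    sumBelow k e                             ≤⟨ sumBelow-mono-≤ k (λ j j<k → e≤a j (≤-trans j<k k≤n)) ⟩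
    sumBelow k (λ _ → a)                     ≡⟨ sumBelow-const k a ⟩
    k * a                                    ≤⟨ *-monoʳ-≤ k (≤-pred (≤-trans a<n (≤-reflexive (sym k+r≡n)))) ⟩
    k * (k′ + r)                             ≡⟨ *-distribˡ-+ k k′ r ⟩
    k * k′ + k * r                           ≡⟨ cong (k * k′ +_) (*-comm k r) ⟩
    k * k′ + r * k                           ≡⟨ cong (k * k′ +_) (sumBelow-from-const n k k) ⟨
    k * k′ + sumBelow n (from k (λ _ → k))   ≤⟨ +-monoʳ-≤ (k * k′) (sumBelow-mono-≤ n tail-k) ⟩
    k * k′ + tailMin n k e                   ∎
    where
      open ≤-Reasoning
      k = suc k′
      r = n ∸ k
      k+r≡n : k + r ≡ n
      k+r≡n = m+[n∸m]≡n k≤n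
      tail-k : ∀ j → j < n → from k (λ _ → k) j ≤ from k (λ j → e j ⊓ k) j
      tail-k j j<n with j <ᵇ k
      ... | true  = ≤-refl
      ... | false = ≤-reflexive (sym (m≥n⇒m⊓n≡n (≤-trans k≤b (b≤e j j<n))))

  module AboveMin (k′ : ℕ) (k≤n : suc k′ ≤ n) (b<k : b < suc k′) where

    k r : ℕ
    k = suc k′
    r = n ∸ k

    k+r≡n : k + r ≡ n
    k+r≡n = m+[n∸m]≡n k≤n

    prefix≤ : sumBelow k e ≤ k * a
    prefix≤ = ≤-trans (sumBelow-mono-≤ k (λ j j<k → e≤a j (≤-trans j<k k≤n))) (≤-reflexive (sumBelow-const k a))

    tail-b : ∀ j → j < n → from k (λ _ → b) j ≤ from k (λ j → e j ⊓ k) j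
    tail-b j j<n with j <ᵇ k
    ... | true  = ≤-refl
    ... | false = ⊓-glb (b≤e j j<n) (<⇒≤ b<k)

    tail≥ : r * b ≤ tailMin n k e
    tail≥ = ≤-trans (≤-reflexive (sym (sumBelow-from-const n k b))) (sumBelow-mono-≤ n tail-b)

    k*a≤ : k * a ≤ k * k′ + r * b + 1
    k*a≤ = prefix-arith a b k′ r b<k (≤-trans bound (≤-reflexive (cong (λ x → x * b + 1) (sym k+r≡n))))

    -- A violation forces equality everywhere: the prefix is all a and the tail all b, so ∑ e is odd.
    module Tight (violation : k * k′ + tailMin n k e < sumBelow k e) where

      k*k′+r*b<prefix : k * k′ + r * b + 1 ≤ sumBelow k e
      k*k′+r*b<prefix = ≤-trans (≤-reflexive (+-comm _ 1)) (≤-trans (s≤s (+-monoʳ-≤ (k * k′) tail≥)) violation)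

      prefix≡ : sumBelow k e ≡ k * a
      prefix≡ = ≤-antisym prefix≤ (≤-trans k*a≤ k*k′+r*b<prefix)

      k*a≡ : k * a ≡ k * k′ + r * b + 1
      k*a≡ = ≤-antisym k*a≤ (≤-trans k*k′+r*b<prefix (≤-reflexive prefix≡))

      tailMin≡ : tailMin n k e ≡ r * b
      tailMin≡ = ≤-antisym (+-cancelˡ-≤ (k * k′) _ _ (≤-pred (begin
        suc (k * k′ + tailMin n k e)  ≤⟨ violation ⟩
        sumBelow k e                  ≤⟨ prefix≤ ⟩
        k * a                         ≤⟨ k*a≤ ⟩
        k * k′ + r * b + 1            ≡⟨ +-comm _ 1 ⟩
        suc (k * k′ + r * b)          ∎))) tail≥
        where open ≤-Reasoning

      tail≡ : ∀ j → j < n → from k e j ≡ from k (λ _ → b) j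
      tail≡ j j<n with sumBelow-mono-≤-≡⇒≗ n tail-b (trans (sumBelow-from-const n k b) (sym tailMin≡)) j j<n
      ... | tail-b≡ with j <ᵇ k
      ...   | true  = refl
      ...   | false with k ≤? e j
      ...     | yes k≤e-j = ⊥-elim (<-irrefl (trans tail-b≡ (m≥n⇒m⊓n≡n k≤e-j)) b<k)
      ...     | no k≰e-j  = sym (trans tail-b≡ (m≤n⇒m⊓n≡m (<⇒≤ (≰⇒> k≰e-j))))

    no-violation : ¬ (k * k′ + tailMin n k e < sumBelow k e)
    no-violation violation = even≢odd (proj₁ even) (h + r * b) (trans (sym (proj₂ even)) odd-sum)
      where
        open Tight violation
        h = proj₁ (Even-*-suc k′)
        regroup : ∀ h x → 2 * h + x + 1 + x ≡ suc (2 * (h + x))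
        regroup = solve-∀
        odd-sum : sumBelow n e ≡ suc (2 * (h + r * b))
        odd-sum = begin
          sumBelow n e                          ≡⟨ sumBelow-split n k e k≤n ⟩
          sumBelow k e + sumBelow n (from k e)  ≡⟨ cong₂ _+_ prefix≡ (trans (sumBelow-cong n tail≡) (sumBelow-from-const n k b)) ⟩
          k * a + r * b                         ≡⟨ cong (_+ r * b) k*a≡ ⟩
          k * k′ + r * b + 1 + r * b            ≡⟨ cong (λ x → x + r * b + 1 + r * b) (trans (*-comm k k′) (proj₂ (Even-*-suc k′))) ⟩
          2 * h + r * b + 1 + r * b             ≡⟨ regroup h (r * b) ⟩
          suc (2 * (h + r * b))                 ∎
          where open ≡-Reasoning

  erdősGallai : ErdősGallai n e
  erdősGallai zero _ = z≤n
  erdősGallai (suc k′) k≤n with suc k′ ≤? b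
  ... | yes k≤b = erdősGallai-≤b k′ k≤n k≤b
  ... | no k≰b  = ≮⇒≥ (AboveMin.no-violation k′ k≤n (≰⇒> k≰b))

  graphic : Graphic d
  graphic = realisation⇒graphic d
    (erdősGallai⇒realisation n e (<-wellFounded _) (toSeq-antitone d decreasing) even erdősGallai)

Ineq⇒base≤ : ∀ {a b n} → Ineq a b n → base a b ≤ n * b + 1
Ineq⇒base≤ {a} {b} {n} (case-one≤ , otherwise≤) with (b % 2 ≟ 1) ⊎-dec ((a + b) % 4 ≟ 1)
... | yes case-one = ≤-trans (m≤n+m∸n (base a b) 1) (subst (1 + (base a b ∸ 1) ≤_) (+-comm 1 (n * b)) (s≤s (case-one≤ case-one)))
... | no ¬case-one = ≤-trans (otherwise≤ ¬case-one) (m≤m+n (n * b) 1)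

-- Sharpness

module DoubleCounting {n} (G : SimpleGraph n) (k : ℕ) (k≤n : k ≤ n) where

  inside : Fin n → Bool
  inside i = toℕ i <ᵇ k

  cross : Fin n → Fin n → ℕ
  cross i j = if inside i then (if inside j then 0 else row G i j) else 0

  sum-inside : ∀ c → sum (λ i → if inside i then c else 0) ≡ k * c
  sum-inside c = trans (sumBelow-upto n k (λ _ → c) k≤n) (sumBelow-const k c)

  inner+1≤k : ∀ i → inside i ≡ true → sum (λ j → if inside j then row G i j else 0) + 1 ≤ k
  inner+1≤k i i-in = begin
    sum (λ j → if inside j then row G i j else 0) + 1             ≡⟨ cong (sum (λ j → if inside j then row G i j else 0) +_) (sum-δ i) ⟨
    sum (λ j → if inside j then row G i j else 0) + sum (δ i)      ≡⟨ ∑-distrib-+ (λ j → if inside j then row G i j else 0) (δ i) ⟨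
    sum (λ j → (if inside j then row G i j else 0) + δ i j)        ≤⟨ sum-mono-≤ pt ⟩
    sum (λ j → if inside j then 1 else 0)                          ≡⟨ trans (sum-inside 1) (*-identityʳ k) ⟩
    k                                                              ∎
    where
      open ≤-Reasoning
      pt : ∀ j → (if inside j then row G i j else 0) + δ i j ≤ (if inside j then 1 else 0)
      pt j = by-cases (j Fin.≟ i)
        where
          by-cases : Dec (j ≡ i) → (if inside j then row G i j else 0) + δ i j ≤ (if inside j then 1 else 0)
          by-cases (yes refl) rewrite i-in | loopless G j | δ-refl j = ≤-refl
          by-cases (no j≢i) rewrite δ-≢ j≢i | +-identityʳ (if inside j then row G i j else 0) with inside j
          ... | true  = b2n≤1 _
          ... | false = z≤n

  degree-inside≤ : ∀ i → (if inside i then degree G i else 0) ≤ (if inside i then k ∸ 1 else 0) + sum (cross i)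
  degree-inside≤ i with inside i in i-in
  ... | false = z≤n
  ... | true  = begin
    degree G i                                                     ≡⟨ trans (degree-∑ G i) (sum-cong-≗ split) ⟩
    sum (λ j → (if inside j then row G i j else 0) + (if inside j then 0 else row G i j))
                                                                   ≡⟨ ∑-distrib-+ (λ j → if inside j then row G i j else 0) _ ⟩
    sum (λ j → if inside j then row G i j else 0) + sum (λ j → if inside j then 0 else row G i j)
                                                                   ≤⟨ +-monoˡ-≤ _ (≤-trans (≤-reflexive (sym (m+n∸n≡m _ 1))) (∸-monoˡ-≤ 1 (inner+1≤k i i-in))) ⟩
    k ∸ 1 + sum (λ j → if inside j then 0 else row G i j)          ∎
    where
      open ≤-Reasoning
      split : ∀ j → row G i j ≡ (if inside j then row G i j else 0) + (if inside j then 0 else row G i j)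
      split j with inside j
      ... | true  = sym (+-identityʳ _)
      ... | false = refl

  cross-into≤ : ∀ j → sum (λ i → cross i j) ≤ (if inside j then 0 else degree G j)
  cross-into≤ j with inside j
  ... | true  = ≤-reflexive (sum-≡0 λ i → if-zero (inside i))
    where
      if-zero : ∀ c → (if c then 0 else 0) ≡ 0
      if-zero true  = refl
      if-zero false = refl
  ... | false = ≤-trans (sum-mono-≤ (λ i → to-row i (inside i))) (≤-reflexive (sym (degree-∑ G j)))
    where
      to-row : ∀ i c → (if c then row G i j else 0) ≤ row G j i
      to-row i true  = ≤-reflexive (cong b2n (adj-sym G i j))
      to-row i false = z≤n

  inside≤ : sum (λ i → if inside i then degree G i else 0) ≤ k * (k ∸ 1) + sum (λ i → if inside i then 0 else degree G i)
  inside≤ = begin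
    sum (λ i → if inside i then degree G i else 0)                             ≤⟨ sum-mono-≤ degree-inside≤ ⟩
    sum (λ i → (if inside i then k ∸ 1 else 0) + sum (cross i))                ≡⟨ ∑-distrib-+ (λ i → if inside i then k ∸ 1 else 0) (sum ∘ cross) ⟩
    sum (λ i → if inside i then k ∸ 1 else 0) + sum (λ i → sum (cross i))      ≡⟨ cong₂ _+_ (sum-inside (k ∸ 1)) (∑-comm cross) ⟩
    k * (k ∸ 1) + sum (λ j → sum (λ i → cross i j))                            ≤⟨ +-monoʳ-≤ (k * (k ∸ 1)) (sum-mono-≤ cross-into≤) ⟩
    k * (k ∸ 1) + sum (λ i → if inside i then 0 else degree G i)               ∎
    where open ≤-Reasoning

realisation⇒prefix-bound : ∀ n d → Realisation n d → ∀ k → k ≤ n → sumBelow k d ≤ k * (k ∸ 1) + sumBelow n (from k d)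
realisation⇒prefix-bound n d (G , degree-G) k k≤n = begin
  sumBelow k d                                                    ≡⟨ sumBelow-upto n k d k≤n ⟨
  sumBelow n (upto k d)                                           ≡⟨ sum-cong-≗ (λ i → cong (λ x → if inside i then x else 0) (degree-G i)) ⟨
  sum (λ i → if inside i then degree G i else 0)                  ≤⟨ inside≤ ⟩
  k * (k ∸ 1) + sum (λ i → if inside i then 0 else degree G i)
    ≡⟨ cong (k * (k ∸ 1) +_) (sum-cong-≗ (λ i → cong (λ x → if inside i then 0 else x) (degree-G i))) ⟩
  k * (k ∸ 1) + sumBelow n (from k d)                             ∎
  where
    open ≤-Reasoning
    open DoubleCounting G k k≤n

-- The sequence (a, …, a, a − p, b, …, b) with k′ leading a's and r trailing b's, where p ∈ {0,1} fixes the parity.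
module Witness (a b n k′ r : ℕ) (0<b : 0 < b) (b<a : b < a) (k+r≡n : suc k′ + r ≡ n) (1≤k′ : 1 ≤ k′) (1≤r : 1 ≤ r)
  (violated : suc k′ * k′ + r * b + 2 ≤ suc k′ * a) where

  k p : ℕ
  k = suc k′
  p = (k * a + r * b) % 2

  p≤1 : p ≤ 1
  p≤1 = ≤-pred (m%n<n (k * a + r * b) 2)

  b≤a∸p : b ≤ a ∸ p
  b≤a∸p = ≤-trans (<⇒≤pred b<a) (∸-monoʳ-≤ a p≤1)

  k≤n : k ≤ n
  k≤n = ≤-trans (m≤m+n k r) (≤-reflexive k+r≡n)

  k<n : k < n
  k<n = ≤-trans (≤-trans (≤-reflexive (+-comm 1 k)) (+-monoʳ-≤ k 1≤r)) (≤-reflexive k+r≡n)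

  s : ℕ → ℕ
  s x = if x <ᵇ k′ then a else (if x <ᵇ k then a ∸ p else b)

  s-< : ∀ x → x < k′ → s x ≡ a
  s-< x x<k′ rewrite <ᵇ-true x<k′ = refl

  s-k′ : s k′ ≡ a ∸ p
  s-k′ rewrite <ᵇ-false {k′} {k′} ≤-refl | <ᵇ-true (n<1+n k′) = refl

  s-≥ : ∀ x → k ≤ x → s x ≡ b
  s-≥ x k≤x rewrite <ᵇ-false {x} {k′} (≤-trans (n≤1+n k′) k≤x) | <ᵇ-false {x} {k} k≤x = refl

  s≤a : ∀ x → s x ≤ a
  s≤a x with x <ᵇ k′ | x <ᵇ k
  ... | true  | _     = ≤-refl
  ... | false | true  = m∸n≤m a p
  ... | false | false = <⇒≤ b<a

  b≤s : ∀ x → b ≤ s x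
  b≤s x with x <ᵇ k′ | x <ᵇ k
  ... | true  | _     = <⇒≤ b<a
  ... | false | true  = b≤a∸p
  ... | false | false = ≤-refl

  s-antitone : ∀ x y → x ≤ y → s y ≤ s x
  s-antitone x y x≤y with y <? k′
  ... | yes y<k′ = ≤-reflexive (trans (s-< y y<k′) (sym (s-< x (≤-<-trans x≤y y<k′))))
  ... | no y≮k′ with y <? k
  ...   | yes y<k = ≤-trans (≤-reflexive (trans (cong s y≡k′) s-k′)) a∸p≤s-x
    where
      y≡k′ : y ≡ k′
      y≡k′ = ≤-antisym (≤-pred y<k) (≮⇒≥ y≮k′)
      a∸p≤s-x : a ∸ p ≤ s x
      a∸p≤s-x rewrite <ᵇ-true (≤-<-trans x≤y y<k) with x <ᵇ k′
      ... | true  = m∸n≤m a p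
      ... | false = ≤-refl
  ...   | no y≮k = ≤-trans (≤-reflexive (s-≥ y (≮⇒≥ y≮k))) (b≤s x)

  prefix-sum : sumBelow k s + p ≡ k * a
  prefix-sum = begin
    sumBelow (suc k′) s + p             ≡⟨ cong (_+ p) (sumBelow-snoc k′ s) ⟩
    sumBelow k′ s + s k′ + p            ≡⟨ cong₂ (λ u v → u + v + p) (trans (sumBelow-cong k′ s-<) (sumBelow-const k′ a)) s-k′ ⟩
    k′ * a + (a ∸ p) + p                ≡⟨ +-assoc (k′ * a) _ p ⟩
    k′ * a + (a ∸ p + p)                ≡⟨ cong (k′ * a +_) (m∸n+n≡m (≤-trans p≤1 (≤-trans 0<b (<⇒≤ b<a)))) ⟩
    k′ * a + a                          ≡⟨ +-comm (k′ * a) a ⟩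
    k * a                               ∎
    where open ≡-Reasoning

  tail-sum : sumBelow n (from k s) ≡ r * b
  tail-sum = begin
    sumBelow n (from k s)               ≡⟨ sumBelow-cong n (λ j _ → tail-b j) ⟩
    sumBelow n (from k (λ _ → b))       ≡⟨ sumBelow-from-const n k b ⟩
    (n ∸ k) * b                         ≡⟨ cong (λ x → (x ∸ k) * b) k+r≡n ⟨
    (k + r ∸ k) * b                     ≡⟨ cong (_* b) (m+n∸m≡n k r) ⟩
    r * b                               ∎
    where
      open ≡-Reasoning
      tail-b : ∀ j → from k s j ≡ from k (λ _ → b) j
      tail-b j with j <? k
      ... | yes j<k = trans (from-< s j<k) (sym (from-< (λ _ → b) j<k))
      ... | no j≮k  = trans (from-≥ s (≮⇒≥ j≮k)) (trans (s-≥ j (≮⇒≥ j≮k)) (sym (from-≥ (λ _ → b) (≮⇒≥ j≮k))))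

  total-sum : sumBelow n s + p ≡ k * a + r * b
  total-sum = begin
    sumBelow n s + p                          ≡⟨ cong (_+ p) (sumBelow-split n k s k≤n) ⟩
    sumBelow k s + sumBelow n (from k s) + p  ≡⟨ cong (λ x → sumBelow k s + x + p) tail-sum ⟩
    sumBelow k s + r * b + p                  ≡⟨ swap-last (sumBelow k s) (r * b) p ⟩
    sumBelow k s + p + r * b                  ≡⟨ cong (_+ r * b) prefix-sum ⟩
    k * a + r * b                             ∎
    where
      open ≡-Reasoning
      swap-last : ∀ x y z → x + y + z ≡ x + z + y
      swap-last = solve-∀

  d : Fin n → ℕ
  d i = s (toℕ i)

  decreasing : Decreasing d
  decreasing i j i≤j = s-antitone (toℕ i) (toℕ j) i≤j

  positive : Positive d
  positive i = ≤-trans 0<b (b≤s (toℕ i))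

  evenSum : EvenSum d
  evenSum = trans (cong (_% 2) sum≡) (m*n%n≡0 (M / 2) 2)
    where
      M = k * a + r * b
      sum≡ : sumFin d ≡ M / 2 * 2
      sum≡ = +-cancelʳ-≡ p (sumFin d) (M / 2 * 2)
        (trans (cong (_+ p) (sumFin≡sum d)) (trans total-sum (trans (m≡m%n+[m/n]*n M 2) (+-comm p _))))

  isMax : IsMax d a
  isMax = (fromℕ< (≤-trans (s≤s z≤n) k≤n) , trans (cong s (toℕ-fromℕ< _)) (s-< 0 1≤k′)) , (λ i → s≤a (toℕ i))

  isMin : IsMin d b
  isMin = (fromℕ< k<n , trans (cong s (toℕ-fromℕ< k<n)) (s-≥ k ≤-refl)) , (λ i → b≤s (toℕ i))

  nonGraphic : ¬ Graphic d
  nonGraphic realised = <⇒≱ prefix-too-large (begin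
    sumBelow k s                           ≤⟨ realisation⇒prefix-bound n s realised k k≤n ⟩
    k * k′ + sumBelow n (from k s)         ≡⟨ cong (k * k′ +_) tail-sum ⟩
    k * k′ + r * b                         ∎)
    where
      open ≤-Reasoning
      prefix-too-large : k * k′ + r * b < sumBelow k s
      prefix-too-large = +-cancelʳ-≤ p _ _ (begin
        suc (k * k′ + r * b) + p           ≤⟨ +-monoʳ-≤ (suc (k * k′ + r * b)) p≤1 ⟩
        suc (k * k′ + r * b) + 1           ≡⟨ +-comm (suc (k * k′ + r * b)) 1 ⟩
        2 + (k * k′ + r * b)               ≡⟨ +-comm 2 _ ⟩
        k * k′ + r * b + 2                 ≤⟨ violated ⟩
        k * a                              ≡⟨ prefix-sum ⟨
        sumBelow k s + p                   ∎)

  nongraphic-sequence : Σ[ d ∈ (Fin n → ℕ) ] Decreasing d × Positive d × EvenSum d × IsMax d a × IsMin d b × ¬ Graphic d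
  nongraphic-sequence = d , decreasing , positive , evenSum , isMax , isMin , nonGraphic

⌊n²/4⌋≡ : ∀ N → (N * N) / 4 ≡ N / 2 * (N / 2 + N % 2)
⌊n²/4⌋≡ N = begin
  (N * N) / 4                               ≡⟨ cong (λ x → (x * x) / 4) (m≡m%n+[m/n]*n N 2) ⟩
  ((ρ + k * 2) * (ρ + k * 2)) / 4           ≡⟨ cong (_/ 4) (expand ρ k) ⟩
  (ρ * ρ + k * (k + ρ) * 4) / 4             ≡⟨ +-distrib-/-∣ʳ (ρ * ρ) (divides-refl (k * (k + ρ))) ⟩
  ρ * ρ / 4 + k * (k + ρ) * 4 / 4           ≡⟨ cong₂ _+_ (m<n⇒m/n≡0 ρ²<4) (m*n/n≡m (k * (k + ρ)) 4) ⟩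
  k * (k + ρ)                               ∎
  where
    open ≡-Reasoning
    k ρ : ℕ
    k = N / 2
    ρ = N % 2
    expand : ∀ ρ k → (ρ + k * 2) * (ρ + k * 2) ≡ ρ * ρ + k * (k + ρ) * 4
    expand = solve-∀
    ρ²<4 : ρ * ρ < 4
    ρ²<4 = s≤s (≤-trans (*-mono-≤ (≤-pred (m%n<n N 2)) (≤-pred (m%n<n N 2))) (s≤s z≤n))

-- base a b = k (k + ρ) where a + b + 1 = 2k + ρ; it is odd only when ρ = 0 and k is odd.
Even-base : ∀ a b → ¬ (a + b) % 4 ≡ 1 → Even (base a b)
Even-base a b ≢1 rewrite ⌊n²/4⌋≡ (a + b + 1) with %2-cases (a + b + 1)
... | inj₂ ρ≡1 rewrite ρ≡1 | +-comm ((a + b + 1) / 2) 1 = Even-*-suc ((a + b + 1) / 2)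
... | inj₁ ρ≡0 rewrite ρ≡0 | +-identityʳ ((a + b + 1) / 2) with %2-cases ((a + b + 1) / 2)
...   | inj₁ k%2≡0 = let h , k≡2h = %2≡0⇒Even k k%2≡0 in h * k , trans (cong (_* k) k≡2h) (*-assoc 2 h k)
  where k = (a + b + 1) / 2
...   | inj₂ k%2≡1 = ⊥-elim (≢1 (trans (cong (_% 4) a+b≡) ([m+kn]%n≡m%n 1 q 4)))
  where
    N = a + b + 1
    q = N / 2 / 2
    a+b≡ : a + b ≡ 1 + q * 4
    a+b≡ = suc-injective (begin
      suc (a + b)                   ≡⟨ +-comm 1 (a + b) ⟩
      N                             ≡⟨ m≡m%n+[m/n]*n N 2 ⟩
      N % 2 + N / 2 * 2             ≡⟨ cong₂ (λ u v → u + v * 2) ρ≡0 (m≡m%n+[m/n]*n (N / 2) 2) ⟩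
      0 + (N / 2 % 2 + q * 2) * 2   ≡⟨ cong (λ u → 0 + (u + q * 2) * 2) k%2≡1 ⟩
      0 + (1 + q * 2) * 2           ≡⟨ expand q ⟩
      suc (1 + q * 4)               ∎)
      where
        open ≡-Reasoning
        expand : ∀ q → 0 + (1 + q * 2) * 2 ≡ suc (1 + q * 4)
        expand = solve-∀

<∸1⇒+2≤ : ∀ x y → x < y ∸ 1 → x + 2 ≤ y
<∸1⇒+2≤ x (suc y) x<y = ≤-trans (≤-reflexive (+-comm x 2)) (s≤s x<y)

2*<⇒+2≤ : ∀ h h′ → 2 * h < 2 * h′ → 2 * h + 2 ≤ 2 * h′
2*<⇒+2≤ h h′ 2h<2h′ = ≤-trans (≤-reflexive (sym (*-suc-+2 h))) (*-monoʳ-≤ 2 (*-cancelˡ-< 2 h h′ 2h<2h′))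
  where
    *-suc-+2 : ∀ h → 2 * suc h ≡ 2 * h + 2
    *-suc-+2 = solve-∀

violation-arith : ∀ a b k′ r ρ → a + b + 1 ≡ ρ + suc k′ * 2 → (suc k′ + r) * b + 2 ≤ suc k′ * (suc k′ + ρ) →
                  suc k′ * k′ + r * b + 2 ≤ suc k′ * a
violation-arith a b k′ r ρ N≡ bound = +-cancelʳ-≤ (k * b + k) _ _ (begin
  k * k′ + r * b + 2 + (k * b + k)   ≡⟨ expand₁ k′ r b ⟩
  k * k + ((k + r) * b + 2)          ≤⟨ +-monoʳ-≤ (k * k) bound ⟩
  k * k + k * (k + ρ)                ≡⟨ expand₂ k′ ρ ⟩
  k * (ρ + k * 2)                    ≡⟨ cong (k *_) N≡ ⟨
  k * (a + b + 1)                    ≡⟨ expand₃ k′ a b ⟩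
  k * a + (k * b + k)                ∎)
  where
    open ≤-Reasoning
    k = suc k′
    expand₁ : ∀ k′ r b → suc k′ * k′ + r * b + 2 + (suc k′ * b + suc k′) ≡ suc k′ * suc k′ + ((suc k′ + r) * b + 2)
    expand₁ = solve-∀
    expand₂ : ∀ k′ ρ → suc k′ * suc k′ + suc k′ * (suc k′ + ρ) ≡ suc k′ * (ρ + suc k′ * 2)
    expand₂ = solve-∀
    expand₃ : ∀ k′ a b → suc k′ * (a + b + 1) ≡ suc k′ * a + (suc k′ * b + suc k′)
    expand₃ = solve-∀

module Sharpness {a b n : ℕ} (0<b : 0 < b) (b<a : b < a) (a<n : a < n) (¬ineq : ¬ Ineq a b n) where

  N k ρ : ℕ
  N = a + b + 1
  k = N / 2
  ρ = N % 2

  N≡ : N ≡ ρ + k * 2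
  N≡ = m≡m%n+[m/n]*n N 2

  gap : n * b + 2 ≤ base a b
  gap with (b % 2 ≟ 1) ⊎-dec ((a + b) % 4 ≟ 1)
  ... | yes case-one =
    <∸1⇒+2≤ (n * b) (base a b) (≰⇒> (λ holds → ¬ineq ((λ _ → holds) , (λ ¬case-one → ⊥-elim (¬case-one case-one)))))
  ... | no ¬case-one with %2-cases b | Even-base a b (λ eq → ¬case-one (inj₂ eq))
  ...   | inj₂ b-odd  | _             = ⊥-elim (¬case-one (inj₁ b-odd))
  ...   | inj₁ b-even | h′ , base≡2h′ =
    let h , b≡2h = %2≡0⇒Even b b-even
        nb≡2nh : n * b ≡ 2 * (n * h)
        nb≡2nh = trans (cong (n *_) b≡2h) (*-comm-2 n h)
        nb<base = ≰⇒> (λ holds → ¬ineq ((λ case-one → ⊥-elim (¬case-one case-one)) , (λ _ → holds)))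
    in subst₂ (λ u v → u + 2 ≤ v) (sym nb≡2nh) (sym base≡2h′)
              (2*<⇒+2≤ (n * h) h′ (subst₂ _<_ nb≡2nh base≡2h′ nb<base))
    where
      *-comm-2 : ∀ n h → n * (2 * h) ≡ 2 * (n * h)
      *-comm-2 = solve-∀

  2≤k : 2 ≤ k
  2≤k with 2 ≤? k
  ... | yes 2≤k = 2≤k
  ... | no 2≰k = ⊥-elim (<⇒≱ N<4 4≤N)
    where
      N<4 : N < 4
      N<4 = s≤s (≤-trans (≤-reflexive N≡) (+-mono-≤ (≤-pred (m%n<n N 2)) (*-monoˡ-≤ 2 (≤-pred (≰⇒> 2≰k)))))
      4≤N : 4 ≤ N
      4≤N = +-mono-≤ (+-mono-≤ (≤-trans (s≤s 0<b) b<a) 0<b) (≤-refl {1})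

  k≤a : k ≤ a
  k≤a = *-cancelʳ-≤ k a 2 (begin
    k * 2           ≤⟨ m≤n+m (k * 2) ρ ⟩
    ρ + k * 2       ≡⟨ N≡ ⟨
    a + b + 1       ≡⟨ +-assoc a b 1 ⟩
    a + (b + 1)     ≤⟨ +-monoʳ-≤ a (≤-trans (≤-reflexive (+-comm b 1)) b<a) ⟩
    a + a           ≡⟨ cong (a +_) (+-identityʳ a) ⟨
    2 * a           ≡⟨ *-comm 2 a ⟩
    a * 2           ∎)
    where open ≤-Reasoning

  k′ r : ℕ
  k′ = pred k
  r = n ∸ k

  suc-k′ : suc k′ ≡ k
  suc-k′ = suc-pred k ⦃ >-nonZero (≤-trans (s≤s z≤n) 2≤k) ⦄

  k<n : k < n
  k<n = ≤-<-trans k≤a a<n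

  k+r≡n : suc k′ + r ≡ n
  k+r≡n = trans (cong (_+ r) suc-k′) (m+[n∸m]≡n (<⇒≤ k<n))

  1≤r : 1 ≤ r
  1≤r = ≤-trans (≤-reflexive (sym (trans (cong (_∸ k) (+-comm 1 k)) (m+n∸m≡n k 1)))) (∸-monoˡ-≤ k k<n)

  1≤k′ : 1 ≤ k′
  1≤k′ = ≤-pred (≤-trans 2≤k (≤-reflexive (sym suc-k′)))

  violated : suc k′ * k′ + r * b + 2 ≤ suc k′ * a
  violated = violation-arith a b k′ r ρ (subst (λ x → N ≡ ρ + x * 2) (sym suc-k′) N≡)
    (subst (λ x → (x + r) * b + 2 ≤ x * (x + ρ)) (sym suc-k′) (begin
      (k + r) * b + 2       ≡⟨ cong (λ x → x * b + 2) (trans (cong (_+ r) (sym suc-k′)) k+r≡n) ⟩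
      n * b + 2             ≤⟨ gap ⟩
      base a b              ≡⟨ ⌊n²/4⌋≡ N ⟩
      k * (k + ρ)           ∎))
    where open ≤-Reasoning

  nongraphic-sequence : Σ[ d ∈ (Fin n → ℕ) ] Decreasing d × Positive d × EvenSum d × IsMax d a × IsMin d b × ¬ Graphic d
  nongraphic-sequence = Witness.nongraphic-sequence a b n k′ r 0<b b<a k+r≡n 1≤k′ 1≤r violated

theorem2 :
    ((n : ℕ) (d : Fin n → ℕ) (a b : ℕ) →
      Decreasing d → Positive d → EvenSum d → IsMax d a → IsMin d b →
      Ineq a b n → Graphic d)
    ×
    ((a b n : ℕ) → 0 < b → b < a → a < n → ¬ Ineq a b n →
      Σ (Fin n → ℕ) λ d →
        Decreasing d × Positive d × EvenSum d × IsMax d a × IsMin d b × ¬ Graphic d)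
theorem2 =
  (λ n d a b decreasing positive evenSum isMax isMin ineq →
     Sufficiency.graphic d decreasing positive evenSum isMax isMin (Ineq⇒base≤ {a} {b} {n} ineq)) ,
  (λ a b n 0<b b<a a<n ¬ineq → Sharpness.nongraphic-sequence 0<b b<a a<n ¬ineq)
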